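{- Let $n,k$ be positive integers and $\ell$ a nonnegative integer. Using the color order on signed permutations, \[ \sum_{w\in\mathfrak{B}_n}q^{\mathrm{fmaj}_{k,\ell}(w)}=(1+q^\ell)^n[n]_{q^k}!, \] \[ \sum_{m\ge0}\big([m+1]_{q^k}+q^\ell[m]_{q^k}\big)^nx^m=\frac{\sum_{w\in\mathfrak{B}_n}x^{\mathrm{des}(w)}q^{\mathrm{fmaj}_{k,\ell}(w)}}{(x;q^k)_{n+1}},\qquad \sum_{m\ge0}(1+q^\ell)^n[m+1]_{q^k}^nx^m=\frac{\sum_{w\in\mathfrak{B}_n}x^{\mathrm{des}^*(w)}q^{\mathrm{fmaj}_{k,\ell}(w)}}{(x;q^k)_{n+1}}. \]
   Context: $\mathfrak{B}_n$: signed permutations $w=w(1)^{c_1}\cdots w(n)^{c_n}$ with $w(1)\cdots w(n)\in\mathfrak{S}_n$ and $c_i\in\{0,1\}$. Color order: $a^j<_cb^k$ iff $j>k$, or $j=k$ and $a<b$ (so $1^1<\cdots<n^1<1^0<\cdots<n^0$). $\mathrm{Des}(w)$ is the set of $i\in[n-1]$ with $w(i)^{c_i}>_cw(i+1)^{c_{i+1}}$, together with $0$ if $c_1=1$; $\mathrm{des}=|\mathrm{Des}|$; $\mathrm{des}^*=|\mathrm{Des}\setminus\{0\}|$; $\mathrm{maj}$ = sum of elements of $\mathrm{Des}$; $\mathrm{neg}(w)=\#\{i:c_i=1\}$; $\mathrm{fmaj}_{k,\ell}(w)=k\,\mathrm{maj}(w)+\ell\,\mathrm{neg}(w)$. $[n]_q=1+q+\cdots+q^{n-1}$,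 $[n]_q!=[1]_q\cdots[n]_q$, $(x;q)_n=\prod_{i=0}^{n-1}(1-xq^i)$. -}

module Defs where

open import Level using (Level)
open import Data.Nat as ℕ using (ℕ; zero; suc; _∸_)
open import Data.Fin using (Fin; _<?_)
open import Data.Bool using (Bool; true; false; if_then_else_)
open import Data.Product using (_×_; _,_; proj₁; proj₂)
open import Data.List using (List; []; _∷_; _++_; length; foldr)
open import Data.Vec using (Vec; toList; zip)
import Data.Vec.Membership.Propositional as VecMem
open import Data.List.Membership.Propositional using (_∈_)
open import Data.List.Relation.Unary.Unique.Propositional using (Unique)
open import Relation.Nullary.Decidable using (⌊_⌋)
open import Algebra.Bundles using (CommutativeRing)

-- A signed permutation w = w(1)^{c_1} ... w(n)^{c_n} is stored as the
-- word w(1)...w(n) (letters in Fin n, i.e. the values 1..n shifted to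
-- 0..n-1) together with the colour vector c_1...c_n, where
-- true = colour 1 (negative) and false = colour 0.

SignedWord : ℕ → Set
SignedWord n = Vec (Fin n) n × Vec Bool n

-- the underlying word is a permutation of [n] (every value occurs;
-- with length n this means it is a bijection)
IsSignedPerm : ∀ {n} → SignedWord n → Set
IsSignedPerm {n} (v , c) = (i : Fin n) → i VecMem.∈ v

Enumerates : ∀ {n} → List (SignedWord n) → Set
Enumerates {n} L =
  Unique L × ((w : SignedWord n) → IsSignedPerm w → w ∈ L)
           × ((w : SignedWord n) → w ∈ L → IsSignedPerm w)

Letter : ℕ → Set
Letter n = Fin n × Bool

_<c_ : ∀ {n} → Letter n → Letter n → Bool
(a , true)  <c (b , false) = true
(a , false) <c (b , true)  = false
(a , true)  <c (b , true)  = ⌊ a <? b ⌋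
(a , false) <c (b , false) = ⌊ a <? b ⌋

letters : ∀ {n} → SignedWord n → List (Letter n)
letters (v , c) = toList (zip v c)

-- positions i (1-based, starting from the given index) with x_i >_c x_{i+1}
desPosFrom : ∀ {n} → ℕ → List (Letter n) → List ℕ
desPosFrom i (x ∷ y ∷ r) =
  (if y <c x then i ∷ [] else []) ++ desPosFrom (suc i) (y ∷ r)
desPosFrom i _ = []

DesStar : ∀ {n} → SignedWord n → List ℕ
DesStar w = desPosFrom 1 (letters w)

firstNeg : ∀ {n} → List (Letter n) → Bool
firstNeg [] = false
firstNeg ((a , c) ∷ _) = c

Des : ∀ {n} → SignedWord n → List ℕ
Des w = (if firstNeg (letters w) then 0 ∷ [] else []) ++ DesStar w

des : ∀ {n} → SignedWord n → ℕ
des w = length (Des w)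

desStar : ∀ {n} → SignedWord n → ℕ
desStar w = length (DesStar w)

maj : ∀ {n} → SignedWord n → ℕ
maj w = foldr ℕ._+_ 0 (Des w)

countTrue : ∀ {m} → Vec Bool m → ℕ
countTrue c = foldr (λ b r → if b then suc r else r) 0 (toList c)

neg : ∀ {n} → SignedWord n → ℕ
neg (v , c) = countTrue c

fmaj : ∀ {n} → ℕ → ℕ → SignedWord n → ℕ
fmaj k ℓ w = k ℕ.* maj w ℕ.+ ℓ ℕ.* neg w

-- Algebra over an arbitrary commutative ring R (q is an element of R;
-- identities for all R and all q are exactly polynomial identities).

module Alg {c ℓ₁ : Level} (R : CommutativeRing c ℓ₁) where
  open CommutativeRing R

  pow : Carrier → ℕ → Carrier
  pow x zero = 1#
  pow x (suc m) = x * pow x m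

  sumBelow : ℕ → (ℕ → Carrier) → Carrier
  sumBelow zero f = 0#
  sumBelow (suc m) f = sumBelow m f + f m

  qint : Carrier → ℕ → Carrier
  qint q m = sumBelow m (pow q)

  qfact : Carrier → ℕ → Carrier
  qfact q zero = 1#
  qfact q (suc m) = qfact q m * qint q (suc m)

  sumList : {A : Set} → (A → Carrier) → List A → Carrier
  sumList f [] = 0#
  sumList f (x ∷ xs) = f x + sumList f xs

  -- formal power series in x, given by coefficient sequences
  Series : Set c
  Series = ℕ → Carrier

  _⋆_ : Series → Series → Series
  (f ⋆ g) m = sumBelow (suc m) (λ j → f j * g (m ∸ j))

  oneS : Series
  oneS zero = 1#
  oneS (suc _) = 0#

  oneMinus : Carrier → Series
  oneMinus a zero = 1#
  oneMinus a (suc zero) = - a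
  oneMinus a (suc (suc _)) = 0#

  poch : Carrier → ℕ → Series
  poch q zero = oneS
  poch q (suc m) = poch q m ⋆ oneMinus (pow q m)

  fmajSum : ∀ {n} → ℕ → ℕ → Carrier → List (SignedWord n) → Carrier
  fmajSum k ℓ q L = sumList (λ w → pow q (fmaj k ℓ w)) L

  statSeries : ∀ {n} → (SignedWord n → ℕ) → ℕ → ℕ → Carrier → List (SignedWord n) → Series
  statSeries s k ℓ q L m =
    sumList (λ w → if s w ℕ.≡ᵇ m then pow q (fmaj k ℓ w) else 0#) L

-- Every signed permutation of [n+1] arises exactly once by inserting the letter
-- n+1, with either colour, into a signed permutation of [n].  Put a virtual
-- letter at position 0, placed in the colour order between the two colours for
-- Des and below everything for Des*.  The insertion slots of a word with d descents can
-- then be ordered so that the j-th one raises maj by j and des by 1 exactly when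
-- j ≥ d + b, where b = 0 iff putting n+1 in front creates a descent at 0.  With
-- Q = q^k and t = q^ℓ, the series P_n(x) = Σ x^des q^fmaj satisfies
-- P_{n+1} = Φ_n P_n for an operator Φ_n built from σ f = f(Qx) and ∂ f = x D_Q f.
-- On the other side the coefficient sequences G_n satisfy
-- G_{n+1} = (1+t) ∂G_n + σ G_n (resp. (1+t)(∂ + σ) G_n), and the q-Leibniz rule
-- shows that multiplying by (x;Q)_{n+2} turns this into the same recursion, so
-- G_n (x;Q)_{n+1} = P_n by induction.  At x = 1 the insertion argument gives
-- the product (1+t)[n+1]_Q per step, whence the fmaj formula.

module Submission where

open import Defs
open import Level using (Level)
open import Data.Nat using (ℕ; suc; _≤_)
open import Data.Product using (_×_)
open import Data.List using (List)
open import Algebra.Bundles using (CommutativeRing)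

open import Algebra.Bundles using (RawRing)
open import Data.Nat as ℕ using (zero; _∸_)
import Data.Nat.Properties as ℕₚ
open import Data.Nat.Solver using (module +-*-Solver)
open import Data.Product using (_,_; proj₁; proj₂)
open import Data.Bool using (Bool; true; false; if_then_else_; not)
open import Data.List as List using ([]; _∷_; _++_; length)
import Data.List.Properties as Listₚ
open import Data.Vec as Vec using (Vec; toList)
import Data.Vec.Properties as Vecₚ
open import Data.Fin using (fromℕ)
open import Function using (_∘_)
import Relation.Binary.PropositionalEquality as ≡
open ≡ using (_≡_; _≢_)

module IntegerSolver {c ℓ} (R : CommutativeRing c ℓ) where
  open import Data.Maybe using (Maybe; just; nothing)
  open import Data.Product.Properties using (≡-dec)
  open import Relation.Nullary using (yes; no)
  open import Algebra.Solver.Ring.AlmostCommutativeRing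
    using (AlmostCommutativeRing; fromCommutativeRing; _-Raw-AlmostCommutative⟶_)
  open CommutativeRing R
  open import Algebra.Properties.Ring ring using (-‿distribˡ-*; -‿distribʳ-*; -‿involutive; -‿+-comm; -0#≈0#)
  open import Algebra.Properties.Semiring.Mult.TCOptimised semiring using (×-homo-+; ×1-homo-*) renaming (_×_ to _×ᵣ_)
  open import Relation.Binary.Reasoning.Setoid setoid

  -- Integer coefficients as pairs (a , b) read as a - b; the operations
  -- normalise so that a or b is 0, which makes _≟_ on pairs decide equality.
  normalise : ℕ → ℕ → ℕ × ℕ
  normalise a b = (a ∸ b , b ∸ a)

  ℤ-rawRing : RawRing _ _
  ℤ-rawRing = record
    { Carrier = ℕ × ℕ
    ; _≈_ = ≡._≡_
    ; _+_ = λ { (a , b) (c , d) → normalise (a ℕ.+ c) (b ℕ.+ d) }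
    ; _*_ = λ { (a , b) (c , d) → normalise (a ℕ.* c ℕ.+ b ℕ.* d) (a ℕ.* d ℕ.+ b ℕ.* c) }
    ; -_ = λ { (a , b) → (b , a) }
    ; 0# = (0 , 0)
    ; 1# = (1 , 0)
    }

  difference : ℕ × ℕ → Carrier
  difference (a , b) = a ×ᵣ 1# - b ×ᵣ 1#

  -- Chosen so that the constants 0 and 1 denote 0# and 1# on the nose.
  ⟦_⟧ : ℕ × ℕ → Carrier
  ⟦ a , zero ⟧ = a ×ᵣ 1#
  ⟦ zero , suc b ⟧ = - (suc b ×ᵣ 1#)
  ⟦ a , b ⟧ = a ×ᵣ 1# - b ×ᵣ 1#

  ⟦⟧≈difference : ∀ z → ⟦ z ⟧ ≈ difference z
  ⟦⟧≈difference (a , zero) = sym (trans (+-congˡ -0#≈0#) (+-identityʳ _))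
  ⟦⟧≈difference (zero , suc b) = sym (+-identityˡ _)
  ⟦⟧≈difference (suc a , suc b) = refl

  -‿+-interchange : ∀ a b c d → (a - b) + (c - d) ≈ (a + c) - (b + d)
  -‿+-interchange a b c d = begin
    (a - b) + (c - d)   ≈⟨ +-assoc a (- b) (c - d) ⟩
    a + (- b + (c - d)) ≈⟨ +-congˡ (sym (+-assoc (- b) c (- d))) ⟩
    a + ((- b + c) - d) ≈⟨ +-congˡ (+-congʳ (+-comm (- b) c)) ⟩
    a + ((c - b) - d)   ≈⟨ +-congˡ (+-assoc c (- b) (- d)) ⟩
    a + (c + (- b - d)) ≈⟨ sym (+-assoc a c _) ⟩
    (a + c) + (- b - d) ≈⟨ +-congˡ (-‿+-comm b d) ⟩
    (a + c) - (b + d)   ∎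

  -‿*-expand : ∀ a b c d → (a - b) * (c - d) ≈ (a * c + b * d) - (a * d + b * c)
  -‿*-expand a b c d = begin
    (a - b) * (c - d)                         ≈⟨ distribʳ (c - d) a (- b) ⟩
    a * (c - d) + - b * (c - d)               ≈⟨ +-cong (distribˡ a c (- d)) (distribˡ (- b) c (- d)) ⟩
    (a * c + a * - d) + (- b * c + - b * - d) ≈⟨ +-cong (+-congˡ (sym (-‿distribʳ-* a d)))
                                                         (+-cong (sym (-‿distribˡ-* b c)) neg*neg) ⟩
    (a * c - a * d) + (- (b * c) + b * d)     ≈⟨ +-congˡ (+-comm _ _) ⟩
    (a * c - a * d) + (b * d - b * c)         ≈⟨ -‿+-interchange _ _ _ _ ⟩
    (a * c + b * d) - (a * d + b * c)         ∎
    where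
    neg*neg : - b * - d ≈ b * d
    neg*neg = trans (sym (-‿distribˡ-* b (- d))) (trans (-‿cong (sym (-‿distribʳ-* b d))) (-‿involutive _))

  normalise-correct : ∀ a b → difference (normalise a b) ≈ difference (a , b)
  normalise-correct zero zero = refl
  normalise-correct zero (suc b) = refl
  normalise-correct (suc a) zero = refl
  normalise-correct (suc a) (suc b) = begin
    difference (normalise a b)               ≈⟨ normalise-correct a b ⟩
    a ×ᵣ 1# - b ×ᵣ 1#                        ≈⟨ sym (+-identityˡ _) ⟩
    0# + (a ×ᵣ 1# - b ×ᵣ 1#)                 ≈⟨ +-congʳ (sym (-‿inverseʳ 1#)) ⟩
    (1# - 1#) + (a ×ᵣ 1# - b ×ᵣ 1#)          ≈⟨ -‿+-interchange 1# 1# (a ×ᵣ 1#) (b ×ᵣ 1#) ⟩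
    (1# + a ×ᵣ 1#) - (1# + b ×ᵣ 1#)          ≈⟨ +-cong (sym (×-homo-+ 1# 1 a)) (-‿cong (sym (×-homo-+ 1# 1 b))) ⟩
    suc a ×ᵣ 1# - suc b ×ᵣ 1#                ∎

  ⟦normalise⟧ : ∀ a b → ⟦ normalise a b ⟧ ≈ difference (a , b)
  ⟦normalise⟧ a b = trans (⟦⟧≈difference (normalise a b)) (normalise-correct a b)

  homomorphism : ℤ-rawRing -Raw-AlmostCommutative⟶ fromCommutativeRing R
  homomorphism = record
    { ⟦_⟧ = ⟦_⟧
    ; +-homo = λ { (a , b) (c , d) → begin
        ⟦ normalise (a ℕ.+ c) (b ℕ.+ d) ⟧          ≈⟨ ⟦normalise⟧ (a ℕ.+ c) (b ℕ.+ d) ⟩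
        (a ℕ.+ c) ×ᵣ 1# - (b ℕ.+ d) ×ᵣ 1#          ≈⟨ +-cong (×-homo-+ 1# a c) (-‿cong (×-homo-+ 1# b d)) ⟩
        (a ×ᵣ 1# + c ×ᵣ 1#) - (b ×ᵣ 1# + d ×ᵣ 1#)  ≈⟨ sym (-‿+-interchange _ _ _ _) ⟩
        difference (a , b) + difference (c , d)    ≈⟨ sym (+-cong (⟦⟧≈difference (a , b)) (⟦⟧≈difference (c , d))) ⟩
        ⟦ a , b ⟧ + ⟦ c , d ⟧                      ∎ }
    ; *-homo = λ { (a , b) (c , d) → begin
        ⟦ normalise (a ℕ.* c ℕ.+ b ℕ.* d) (a ℕ.* d ℕ.+ b ℕ.* c) ⟧
          ≈⟨ ⟦normalise⟧ (a ℕ.* c ℕ.+ b ℕ.* d) (a ℕ.* d ℕ.+ b ℕ.* c) ⟩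
        (a ℕ.* c ℕ.+ b ℕ.* d) ×ᵣ 1# - (a ℕ.* d ℕ.+ b ℕ.* c) ×ᵣ 1#
          ≈⟨ +-cong (sum-of-products a c b d) (-‿cong (sum-of-products a d b c)) ⟩
        (a ×ᵣ 1# * (c ×ᵣ 1#) + b ×ᵣ 1# * (d ×ᵣ 1#)) - (a ×ᵣ 1# * (d ×ᵣ 1#) + b ×ᵣ 1# * (c ×ᵣ 1#))
          ≈⟨ sym (-‿*-expand _ _ _ _) ⟩
        difference (a , b) * difference (c , d)
          ≈⟨ sym (*-cong (⟦⟧≈difference (a , b)) (⟦⟧≈difference (c , d))) ⟩
        ⟦ a , b ⟧ * ⟦ c , d ⟧ ∎ }
    ; -‿homo = λ { (a , b) → begin
        ⟦ b , a ⟧                  ≈⟨ ⟦⟧≈difference (b , a) ⟩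
        b ×ᵣ 1# - a ×ᵣ 1#          ≈⟨ +-comm _ _ ⟩
        - (a ×ᵣ 1#) + b ×ᵣ 1#      ≈⟨ +-congˡ (sym (-‿involutive _)) ⟩
        - (a ×ᵣ 1#) - - (b ×ᵣ 1#)  ≈⟨ -‿+-comm _ _ ⟩
        - difference (a , b)       ≈⟨ -‿cong (sym (⟦⟧≈difference (a , b))) ⟩
        - ⟦ a , b ⟧                ∎ }
    ; 0-homo = refl
    ; 1-homo = refl
    }
    where
    sum-of-products : ∀ a c b d → (a ℕ.* c ℕ.+ b ℕ.* d) ×ᵣ 1# ≈ a ×ᵣ 1# * (c ×ᵣ 1#) + b ×ᵣ 1# * (d ×ᵣ 1#)
    sum-of-products a c b d = trans (×-homo-+ 1# (a ℕ.* c) (b ℕ.* d)) (+-cong (×1-homo-* a c) (×1-homo-* b d))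

  _≟ℤ_ : ∀ x y → Maybe (⟦ x ⟧ ≈ ⟦ y ⟧)
  x ≟ℤ y with ≡-dec ℕₚ._≟_ ℕₚ._≟_ x y
  ... | yes ≡.refl = just refl
  ... | no _ = nothing

  open import Algebra.Solver.Ring ℤ-rawRing (fromCommutativeRing R) homomorphism _≟ℤ_ public
    using (solve; _:=_; _:+_; _:*_; _:-_; :-_; con)

module AlgProperties {c ℓ} (R : CommutativeRing c ℓ) where
  open import Data.List using (concatMap)
  open import Data.List.Relation.Unary.All using (All; []; _∷_)
  import Data.List.Relation.Binary.Permutation.Propositional as ↭
  open CommutativeRing R
  open Alg R
  open import Relation.Binary.Reasoning.Setoid setoid
  open IntegerSolver R using (solve; _:=_; _:+_; _:*_)
  open import Algebra.Properties.Ring ring using (-0#≈0#; -‿+-comm)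

  pow-+ : ∀ y m n → pow y (m ℕ.+ n) ≈ pow y m * pow y n
  pow-+ y zero n = sym (*-identityˡ _)
  pow-+ y (suc m) n = trans (*-congˡ (pow-+ y m n)) (sym (*-assoc _ _ _))

  pow-* : ∀ y z n → pow (y * z) n ≈ pow y n * pow z n
  pow-* y z zero = sym (*-identityˡ _)
  pow-* y z (suc n) = trans (*-congˡ (pow-* y z n))
    (solve 4 (λ a b c d → (a :* b) :* (c :* d) := (a :* c) :* (b :* d)) refl _ _ _ _)

  pow-pow : ∀ y k m → pow y (k ℕ.* m) ≈ pow (pow y k) m
  pow-pow y k zero = reflexive (≡.cong (pow y) (ℕₚ.*-zeroʳ k))
  pow-pow y k (suc m) = begin
    pow y (k ℕ.* suc m)         ≡⟨ ≡.cong (pow y) (ℕₚ.*-suc k m) ⟩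
    pow y (k ℕ.+ k ℕ.* m)       ≈⟨ pow-+ y k (k ℕ.* m) ⟩
    pow y k * pow y (k ℕ.* m)   ≈⟨ *-congˡ (pow-pow y k m) ⟩
    pow y k * pow (pow y k) m   ∎

  pow-1# : ∀ m → pow 1# m ≈ 1#
  pow-1# zero = refl
  pow-1# (suc m) = trans (*-identityˡ _) (pow-1# m)

  sumBelow-cong : ∀ n {h h′} → (∀ j → h j ≈ h′ j) → sumBelow n h ≈ sumBelow n h′
  sumBelow-cong zero e = refl
  sumBelow-cong (suc n) e = +-cong (sumBelow-cong n e) (e n)

  sumBelow-cong< : ∀ n {h h′} → (∀ j → j ℕ.< n → h j ≈ h′ j) → sumBelow n h ≈ sumBelow n h′
  sumBelow-cong< zero e = refl
  sumBelow-cong< (suc n) e = +-cong (sumBelow-cong< n (λ j j<n → e j (ℕₚ.m<n⇒m<1+n j<n))) (e n ℕₚ.≤-refl)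

  sumBelow-suc : ∀ n h → sumBelow (suc n) h ≈ h 0 + sumBelow n (λ j → h (suc j))
  sumBelow-suc zero h = trans (+-identityˡ _) (sym (+-identityʳ _))
  sumBelow-suc (suc n) h = trans (+-congʳ (sumBelow-suc n h)) (+-assoc _ _ _)

  sumBelow-+ : ∀ n h h′ → sumBelow n (λ j → h j + h′ j) ≈ sumBelow n h + sumBelow n h′
  sumBelow-+ zero h h′ = sym (+-identityˡ _)
  sumBelow-+ (suc n) h h′ = trans (+-congʳ (sumBelow-+ n h h′))
    (solve 4 (λ a b x y → (a :+ b) :+ (x :+ y) := (a :+ x) :+ (b :+ y)) refl _ _ _ _)

  sumBelow-*ˡ : ∀ n a h → sumBelow n (λ j → a * h j) ≈ a * sumBelow n h
  sumBelow-*ˡ zero a h = sym (zeroʳ a)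
  sumBelow-*ˡ (suc n) a h = trans (+-congʳ (sumBelow-*ˡ n a h)) (sym (distribˡ _ _ _))

  sumBelow-0# : ∀ n → sumBelow n (λ _ → 0#) ≈ 0#
  sumBelow-0# zero = refl
  sumBelow-0# (suc n) = trans (+-identityʳ _) (sumBelow-0# n)

  sumBelow-neg : ∀ n h → sumBelow n (λ j → - h j) ≈ - sumBelow n h
  sumBelow-neg zero h = sym -0#≈0#
  sumBelow-neg (suc n) h = trans (+-congʳ (sumBelow-neg n h)) (-‿+-comm _ _)

  qint-suc : ∀ q n → qint q (suc n) ≈ 1# + q * qint q n
  qint-suc q zero = trans (+-identityˡ _) (sym (trans (+-congˡ (zeroʳ q)) (+-identityʳ _)))
  qint-suc q (suc n) = begin
    qint q (suc n) + pow q (suc n)    ≈⟨ +-congʳ (qint-suc q n) ⟩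
    (1# + q * qint q n) + q * pow q n ≈⟨ +-assoc _ _ _ ⟩
    1# + (q * qint q n + q * pow q n) ≈⟨ +-congˡ (sym (distribˡ q _ _)) ⟩
    1# + q * qint q (suc n)           ∎

  qint-+ : ∀ q a b → qint q (a ℕ.+ b) ≈ qint q a + pow q a * qint q b
  qint-+ q a zero = trans (reflexive (≡.cong (qint q) (ℕₚ.+-identityʳ a)))
                          (sym (trans (+-congˡ (zeroʳ _)) (+-identityʳ _)))
  qint-+ q a (suc b) = begin
    qint q (a ℕ.+ suc b)                                 ≡⟨ ≡.cong (qint q) (ℕₚ.+-suc a b) ⟩
    qint q (a ℕ.+ b) + pow q (a ℕ.+ b)                   ≈⟨ +-cong (qint-+ q a b) (pow-+ q a b) ⟩
    (qint q a + pow q a * qint q b) + pow q a * pow q b  ≈⟨ +-assoc _ _ _ ⟩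
    qint q a + (pow q a * qint q b + pow q a * pow q b)  ≈⟨ +-congˡ (sym (distribˡ _ _ _)) ⟩
    qint q a + pow q a * qint q (suc b)                  ∎

  module _ {A : Set} where
    sumList-cong : ∀ {f g : A → Carrier} xs → (∀ x → f x ≈ g x) → sumList f xs ≈ sumList g xs
    sumList-cong [] e = refl
    sumList-cong (x ∷ xs) e = +-cong (e x) (sumList-cong xs e)

    sumList-All-cong : ∀ {f g : A → Carrier} {xs} → All (λ x → f x ≈ g x) xs → sumList f xs ≈ sumList g xs
    sumList-All-cong [] = refl
    sumList-All-cong (e ∷ es) = +-cong e (sumList-All-cong es)

    sumList-++ : ∀ (f : A → Carrier) xs ys → sumList f (xs ++ ys) ≈ sumList f xs + sumList f ys
    sumList-++ f [] ys = sym (+-identityˡ _)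
    sumList-++ f (x ∷ xs) ys = trans (+-congˡ (sumList-++ f xs ys)) (sym (+-assoc _ _ _))

    sumList-*ʳ : ∀ (f : A → Carrier) a xs → sumList (λ x → f x * a) xs ≈ sumList f xs * a
    sumList-*ʳ f a [] = sym (zeroˡ a)
    sumList-*ʳ f a (x ∷ xs) = trans (+-congˡ (sumList-*ʳ f a xs)) (sym (distribʳ _ _ _))

    sumList-*ˡ : ∀ (f : A → Carrier) a xs → sumList (λ x → a * f x) xs ≈ a * sumList f xs
    sumList-*ˡ f a [] = sym (zeroʳ a)
    sumList-*ˡ f a (x ∷ xs) = trans (+-congˡ (sumList-*ˡ f a xs)) (sym (distribˡ _ _ _))

    sumList-↭ : ∀ (f : A → Carrier) {xs ys} → xs ↭.↭ ys → sumList f xs ≈ sumList f ys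
    sumList-↭ f ↭.refl = refl
    sumList-↭ f (↭.prep x p) = +-congˡ (sumList-↭ f p)
    sumList-↭ f (↭.swap x y p) = trans (solve 3 (λ a b c → a :+ (b :+ c) := b :+ (a :+ c)) refl _ _ _)
                                       (+-congˡ (+-congˡ (sumList-↭ f p)))
    sumList-↭ f (↭.trans p q) = trans (sumList-↭ f p) (sumList-↭ f q)

  module _ {A B : Set} where
    sumList-map : ∀ (f : B → Carrier) (g : A → B) xs → sumList f (List.map g xs) ≈ sumList (λ x → f (g x)) xs
    sumList-map f g [] = refl
    sumList-map f g (x ∷ xs) = +-congˡ (sumList-map f g xs)

    sumList-concatMap : ∀ (f : B → Carrier) (g : A → List B) xs →
                        sumList f (concatMap g xs) ≈ sumList (λ x → sumList f (g x)) xs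
    sumList-concatMap f g [] = refl
    sumList-concatMap f g (x ∷ xs) = trans (sumList-++ f (g x) (concatMap g xs)) (+-congˡ (sumList-concatMap f g xs))

module PowerSeries {c ℓ} (R : CommutativeRing c ℓ) where
  open import Relation.Binary.Structures using (IsEquivalence)
  open CommutativeRing R
  open Alg R
  open AlgProperties R
  open import Relation.Binary.Reasoning.Setoid setoid
  open IntegerSolver R using (solve; _:=_; _:+_; _:*_)

  infix 4 _≋_
  infixl 6 _⊕_
  infixl 7 _⊙_

  _≋_ : Series → Series → Set ℓ
  f ≋ g = ∀ m → f m ≈ g m

  shift : Series → Series
  shift f m = f (suc m)

  0ₛ : Series
  0ₛ _ = 0#

  _⊕_ : Series → Series → Series
  (f ⊕ g) m = f m + g m

  ⊝_ : Series → Series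
  (⊝ f) m = - f m

  _⊙_ : Carrier → Series → Series
  (a ⊙ f) m = a * f m

  ⋆-cong : ∀ {f f′ g g′} → f ≋ f′ → g ≋ g′ → f ⋆ g ≋ f′ ⋆ g′
  ⋆-cong ef eg m = sumBelow-cong (suc m) (λ j → *-cong (ef j) (eg (m ∸ j)))

  ⋆-congˡ : ∀ f {g g′} → g ≋ g′ → f ⋆ g ≋ f ⋆ g′
  ⋆-congˡ f = ⋆-cong {f} {f} (λ _ → refl)

  ⋆-congʳ : ∀ g {f f′} → f ≋ f′ → f ⋆ g ≋ f′ ⋆ g
  ⋆-congʳ g e = ⋆-cong {g = g} {g′ = g} e (λ _ → refl)

  ⋆-at-0 : ∀ f g → (f ⋆ g) 0 ≈ f 0 * g 0
  ⋆-at-0 f g = +-identityˡ _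

  ⋆-at-suc : ∀ f g m → (f ⋆ g) (suc m) ≈ f 0 * g (suc m) + (shift f ⋆ g) m
  ⋆-at-suc f g m = sumBelow-suc (suc m) (λ j → f j * g (suc m ∸ j))

  ⋆-at-sucʳ : ∀ f g m → (f ⋆ g) (suc m) ≈ (f ⋆ shift g) m + f (suc m) * g 0
  ⋆-at-sucʳ f g m =
    +-cong (sumBelow-cong< (suc m) λ j j<1+m → *-congˡ (reflexive (≡.cong g (ℕₚ.+-∸-assoc 1 (ℕₚ.≤-pred j<1+m)))))
           (*-congˡ (reflexive (≡.cong g (ℕₚ.n∸n≡0 m))))

  ⋆-comm : ∀ f g → f ⋆ g ≋ g ⋆ f
  ⋆-comm f g zero = +-congˡ (*-comm _ _)
  ⋆-comm f g (suc m) = begin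
    (f ⋆ g) (suc m)                        ≈⟨ ⋆-at-suc f g m ⟩
    f 0 * g (suc m) + (shift f ⋆ g) m      ≈⟨ +-cong (*-comm _ _) (⋆-comm (shift f) g m) ⟩
    g (suc m) * f 0 + (g ⋆ shift f) m      ≈⟨ +-comm _ _ ⟩
    (g ⋆ shift f) m + g (suc m) * f 0      ≈⟨ sym (⋆-at-sucʳ g f m) ⟩
    (g ⋆ f) (suc m)                        ∎

  ⋆-distribˡ : ∀ f g h → f ⋆ (g ⊕ h) ≋ f ⋆ g ⊕ f ⋆ h
  ⋆-distribˡ f g h m = trans (sumBelow-cong (suc m) (λ j → distribˡ _ _ _)) (sumBelow-+ (suc m) _ _)

  ⋆-distribʳ : ∀ f g h → (g ⊕ h) ⋆ f ≋ g ⋆ f ⊕ h ⋆ f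
  ⋆-distribʳ f g h m = trans (sumBelow-cong (suc m) (λ j → distribʳ _ _ _)) (sumBelow-+ (suc m) _ _)

  ⊙-⋆ : ∀ a f g → (a ⊙ f) ⋆ g ≋ a ⊙ (f ⋆ g)
  ⊙-⋆ a f g m = trans (sumBelow-cong (suc m) (λ j → *-assoc _ _ _)) (sumBelow-*ˡ (suc m) a _)

  ⋆-zeroˡ : ∀ g → 0ₛ ⋆ g ≋ 0ₛ
  ⋆-zeroˡ g m = trans (sumBelow-cong (suc m) (λ j → zeroˡ _)) (sumBelow-0# (suc m))

  ⋆-identityˡ : ∀ g → oneS ⋆ g ≋ g
  ⋆-identityˡ g zero = trans (+-identityˡ _) (*-identityˡ _)
  ⋆-identityˡ g (suc m) = begin
    (oneS ⋆ g) (suc m)                        ≈⟨ ⋆-at-suc oneS g m ⟩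
    1# * g (suc m) + (shift oneS ⋆ g) m       ≈⟨ +-cong (*-identityˡ _) (⋆-zeroˡ g m) ⟩
    g (suc m) + 0#                            ≈⟨ +-identityʳ _ ⟩
    g (suc m)                                 ∎

  ⋆-assoc : ∀ f g h → (f ⋆ g) ⋆ h ≋ f ⋆ (g ⋆ h)
  ⋆-assoc f g h zero = begin
    ((f ⋆ g) ⋆ h) 0      ≈⟨ trans (⋆-at-0 (f ⋆ g) h) (*-congʳ (⋆-at-0 f g)) ⟩
    (f 0 * g 0) * h 0    ≈⟨ *-assoc _ _ _ ⟩
    f 0 * (g 0 * h 0)    ≈⟨ sym (trans (⋆-at-0 f (g ⋆ h)) (*-congˡ (⋆-at-0 g h))) ⟩
    (f ⋆ (g ⋆ h)) 0      ∎
  ⋆-assoc f g h (suc m) = begin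
    ((f ⋆ g) ⋆ h) (suc m)
      ≈⟨ ⋆-at-suc (f ⋆ g) h m ⟩
    (f ⋆ g) 0 * h (suc m) + (shift (f ⋆ g) ⋆ h) m
      ≈⟨ +-cong (*-congʳ (⋆-at-0 f g)) (⋆-congʳ h (⋆-at-suc f g) m) ⟩
    (f 0 * g 0) * h (suc m) + ((f 0 ⊙ shift g ⊕ shift f ⋆ g) ⋆ h) m
      ≈⟨ +-congˡ (trans (⋆-distribʳ h _ _ m) (+-cong (⊙-⋆ (f 0) (shift g) h m) (⋆-assoc (shift f) g h m))) ⟩
    (f 0 * g 0) * h (suc m) + (f 0 * (shift g ⋆ h) m + (shift f ⋆ (g ⋆ h)) m)
      ≈⟨ solve 5 (λ a b c d e → (a :* b) :* c :+ (a :* d :+ e) := a :* (b :* c :+ d) :+ e) refl _ _ _ _ _ ⟩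
    f 0 * (g 0 * h (suc m) + (shift g ⋆ h) m) + (shift f ⋆ (g ⋆ h)) m
      ≈⟨ +-congʳ (*-congˡ (sym (⋆-at-suc g h m))) ⟩
    f 0 * (g ⋆ h) (suc m) + (shift f ⋆ (g ⋆ h)) m
      ≈⟨ sym (⋆-at-suc f (g ⋆ h) m) ⟩
    (f ⋆ (g ⋆ h)) (suc m) ∎

  ≋-isEquivalence : IsEquivalence _≋_
  ≋-isEquivalence = record
    { refl = λ _ → refl ; sym = λ e m → sym (e m) ; trans = λ e e′ m → trans (e m) (e′ m) }

  seriesRing : CommutativeRing c ℓ
  seriesRing = record
    { Carrier = Series ; _≈_ = _≋_ ; _+_ = _⊕_ ; _*_ = _⋆_ ; -_ = ⊝_ ; 0# = 0ₛ ; 1# = oneS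
    ; isCommutativeRing = record
      { isRing = record
        { +-isAbelianGroup = record
          { isGroup = record
            { isMonoid = record
              { isSemigroup = record
                { isMagma = record { isEquivalence = ≋-isEquivalence ; ∙-cong = λ e e′ m → +-cong (e m) (e′ m) }
                ; assoc = λ f g h m → +-assoc _ _ _ }
              ; identity = (λ f m → +-identityˡ _) , (λ f m → +-identityʳ _) }
            ; inverse = (λ f m → -‿inverseˡ _) , (λ f m → -‿inverseʳ _)
            ; ⁻¹-cong = λ e m → -‿cong (e m) }
          ; comm = λ f g m → +-comm _ _ }
        ; *-cong = ⋆-cong
        ; *-assoc = ⋆-assoc
        ; *-identity = ⋆-identityˡ , (λ g m → trans (⋆-comm g oneS m) (⋆-identityˡ g m))
        ; distrib = ⋆-distribˡ , ⋆-distribʳ }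
      ; *-comm = ⋆-comm } }

-- σ f = f(Q x) and ∂ f = x D_Q f act on coefficients by Q^m and [m]_Q.
module QOperators {c ℓ} (R : CommutativeRing c ℓ) (Q : CommutativeRing.Carrier R) where
  open CommutativeRing R
  open Alg R
  open AlgProperties R
  open PowerSeries R
  open import Relation.Binary.Reasoning.Setoid setoid
  open IntegerSolver R using (solve; _:=_; _:+_; _:*_; con)
  open import Algebra.Properties.Ring ring using (-0#≈0#; -‿distribʳ-*)
  private module 𝕊 = CommutativeRing seriesRing

  const : Carrier → Series
  const a = a ⊙ oneS

  X : Series
  X zero = 0#
  X (suc zero) = 1#
  X (suc (suc _)) = 0#

  σ : Series → Series
  σ f m = pow Q m * f m

  ∂ : Series → Series
  ∂ f m = qint Q m * f m

  1-X : Series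
  1-X = oneMinus 1#

  const-⋆ : ∀ a f → const a ⋆ f ≋ a ⊙ f
  const-⋆ a f m = trans (⊙-⋆ a oneS f m) (*-congˡ (⋆-identityˡ f m))

  const-cong : ∀ {a b} → a ≈ b → const a ≋ const b
  const-cong e m = *-congʳ e

  const-+ : ∀ a b → const (a + b) ≋ const a ⊕ const b
  const-+ a b m = distribʳ _ _ _

  const-* : ∀ a b → const (a * b) ≋ const a ⋆ const b
  const-* a b m = trans (*-assoc _ _ _) (sym (const-⋆ a (const b) m))

  const-0# : const 0# ≋ 0ₛ
  const-0# m = zeroˡ _

  const-1# : const 1# ≋ oneS
  const-1# m = *-identityˡ _

  const-pow : ∀ a j → Alg.pow seriesRing (const a) j ≋ const (pow a j)
  const-pow a zero = 𝕊.sym const-1#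
  const-pow a (suc j) = 𝕊.trans (⋆-congˡ (const a) (const-pow a j)) (𝕊.sym (const-* a (pow a j)))

  const-qint : ∀ a j → Alg.qint seriesRing (const a) j ≋ const (qint a j)
  const-qint a zero = 𝕊.sym const-0#
  const-qint a (suc j) = 𝕊.trans (𝕊.+-cong (const-qint a j) (const-pow a j)) (𝕊.sym (const-+ (qint a j) (pow a j)))

  X-⋆-at-0 : ∀ f → (X ⋆ f) 0 ≈ 0#
  X-⋆-at-0 f = trans (⋆-at-0 X f) (zeroˡ _)

  X-⋆-at-suc : ∀ f m → (X ⋆ f) (suc m) ≈ f m
  X-⋆-at-suc f m = begin
    (X ⋆ f) (suc m)                    ≈⟨ ⋆-at-suc X f m ⟩
    0# * f (suc m) + (shift X ⋆ f) m   ≈⟨ +-cong (zeroˡ _) (trans (⋆-congʳ f shift-X m) (⋆-identityˡ f m)) ⟩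
    0# + f m                           ≈⟨ +-identityˡ _ ⟩
    f m                                ∎
    where
    shift-X : shift X ≋ oneS
    shift-X zero = refl
    shift-X (suc m) = refl

  oneMinus≋1-aX : ∀ a → oneMinus a ≋ oneS ⊕ ⊝ (const a ⋆ X)
  oneMinus≋1-aX a zero = sym (trans (+-congˡ (-‿cong (trans (const-⋆ a X 0) (zeroʳ a))))
                                     (trans (+-congˡ -0#≈0#) (+-identityʳ _)))
  oneMinus≋1-aX a (suc zero) = sym (trans (+-identityˡ _) (-‿cong (trans (const-⋆ a X 1) (*-identityʳ a))))
  oneMinus≋1-aX a (suc (suc m)) = sym (trans (+-congˡ (-‿cong (trans (const-⋆ a X (suc (suc m))) (zeroʳ a))))
                                             (trans (+-congˡ -0#≈0#) (+-identityʳ _)))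

  1-X≋1⊕⊝X : 1-X ≋ oneS ⊕ ⊝ X
  1-X≋1⊕⊝X = 𝕊.trans (oneMinus≋1-aX 1#) (𝕊.+-congˡ (𝕊.-‿cong (𝕊.trans (⋆-congʳ X const-1#) (⋆-identityˡ X))))

  σ-cong : ∀ {f g} → f ≋ g → σ f ≋ σ g
  σ-cong e m = *-congˡ (e m)

  ∂-cong : ∀ {f g} → f ≋ g → ∂ f ≋ ∂ g
  ∂-cong e m = *-congˡ (e m)

  σ-⊕ : ∀ f g → σ (f ⊕ g) ≋ σ f ⊕ σ g
  σ-⊕ f g m = distribˡ _ _ _

  ∂-⊕ : ∀ f g → ∂ (f ⊕ g) ≋ ∂ f ⊕ ∂ g
  ∂-⊕ f g m = distribˡ _ _ _

  σ-0ₛ : σ 0ₛ ≋ 0ₛ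
  σ-0ₛ m = zeroʳ _

  ∂-0ₛ : ∂ 0ₛ ≋ 0ₛ
  ∂-0ₛ m = zeroʳ _

  σ-⋆ : ∀ f g → σ (f ⋆ g) ≋ σ f ⋆ σ g
  σ-⋆ f g zero = begin
    1# * (f ⋆ g) 0            ≈⟨ *-congˡ (⋆-at-0 f g) ⟩
    1# * (f 0 * g 0)          ≈⟨ solve 2 (λ a b → con (1 , 0) :* (a :* b) := (con (1 , 0) :* a) :* (con (1 , 0) :* b)) refl (f 0) (g 0) ⟩
    (1# * f 0) * (1# * g 0)   ≈⟨ sym (⋆-at-0 (σ f) (σ g)) ⟩
    (σ f ⋆ σ g) 0             ∎
  σ-⋆ f g (suc m) = begin
    (Q * pow Q m) * (f ⋆ g) (suc m)
      ≈⟨ *-congˡ (⋆-at-suc f g m) ⟩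
    (Q * pow Q m) * (f 0 * g (suc m) + (shift f ⋆ g) m)
      ≈⟨ solve 5 (λ Q Qm a b A → (Q :* Qm) :* (a :* b :+ A) := (con (1 , 0) :* a) :* ((Q :* Qm) :* b) :+ Q :* (Qm :* A))
               refl Q (pow Q m) (f 0) (g (suc m)) ((shift f ⋆ g) m) ⟩
    (1# * f 0) * σ g (suc m) + Q * σ (shift f ⋆ g) m
      ≈⟨ +-congˡ (*-congˡ (σ-⋆ (shift f) g m)) ⟩
    (1# * f 0) * σ g (suc m) + Q * (σ (shift f) ⋆ σ g) m
      ≈⟨ +-congˡ (sym (⊙-⋆ Q (σ (shift f)) (σ g) m)) ⟩
    (1# * f 0) * σ g (suc m) + ((Q ⊙ σ (shift f)) ⋆ σ g) m
      ≈⟨ +-congˡ (⋆-congʳ (σ g) (λ j → *-assoc Q (pow Q j) (f (suc j))) m) ⟨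
    (1# * f 0) * σ g (suc m) + (shift (σ f) ⋆ σ g) m
      ≈⟨ sym (⋆-at-suc (σ f) (σ g) m) ⟩
    (σ f ⋆ σ g) (suc m) ∎

  ∂-⋆ : ∀ f g → ∂ (f ⋆ g) ≋ ∂ f ⋆ g ⊕ σ f ⋆ ∂ g
  ∂-⋆ f g zero = begin
    0# * (f ⋆ g) 0                              ≈⟨ *-congˡ (⋆-at-0 f g) ⟩
    0# * (f 0 * g 0)                            ≈⟨ solve 2 (λ a b → con (0 , 0) :* (a :* b) := (con (0 , 0) :* a) :* b :+ (con (1 , 0) :* a) :* (con (0 , 0) :* b)) refl (f 0) (g 0) ⟩
    (0# * f 0) * g 0 + (1# * f 0) * (0# * g 0)  ≈⟨ sym (+-cong (⋆-at-0 (∂ f) g) (⋆-at-0 (σ f) (∂ g))) ⟩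
    (∂ f ⋆ g) 0 + (σ f ⋆ ∂ g) 0                 ∎
  ∂-⋆ f g (suc m) = begin
    qint Q (suc m) * (f ⋆ g) (suc m)
      ≈⟨ *-cong (qint-suc Q m) (⋆-at-suc f g m) ⟩
    (1# + Q * I) * (f 0 * g (suc m) + A)
      ≈⟨ solve 5 (λ Q I a b A → (con (1 , 0) :+ Q :* I) :* (a :* b :+ A)
                              := ((con (0 , 0) :* a) :* b :+ A) :+ ((con (1 , 0) :* a) :* ((con (1 , 0) :+ Q :* I) :* b) :+ Q :* (I :* A)))
               refl Q I (f 0) (g (suc m)) A ⟩
    ((0# * f 0) * g (suc m) + A) + ((1# * f 0) * ((1# + Q * I) * g (suc m)) + Q * (I * A))
      ≈⟨ +-congˡ (+-congˡ (*-congˡ (∂-⋆ (shift f) g m))) ⟩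
    ((0# * f 0) * g (suc m) + A) + ((1# * f 0) * ((1# + Q * I) * g (suc m)) + Q * (B + C))
      ≈⟨ solve 7 (λ Q I a b A B C → ((con (0 , 0) :* a) :* b :+ A) :+ ((con (1 , 0) :* a) :* ((con (1 , 0) :+ Q :* I) :* b) :+ Q :* (B :+ C))
                                  := ((con (0 , 0) :* a) :* b :+ (A :+ Q :* B)) :+ ((con (1 , 0) :* a) :* ((con (1 , 0) :+ Q :* I) :* b) :+ Q :* C))
               refl Q I (f 0) (g (suc m)) A B C ⟩
    ((0# * f 0) * g (suc m) + (A + Q * B)) + ((1# * f 0) * ((1# + Q * I) * g (suc m)) + Q * C)
      ≈⟨ +-cong (+-congˡ shift-∂-term) (+-cong (*-congˡ (*-congʳ (sym (qint-suc Q m)))) shift-σ-term) ⟩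
    ((0# * f 0) * g (suc m) + (shift (∂ f) ⋆ g) m) + ((1# * f 0) * ∂ g (suc m) + (shift (σ f) ⋆ ∂ g) m)
      ≈⟨ sym (+-cong (⋆-at-suc (∂ f) g m) (⋆-at-suc (σ f) (∂ g) m)) ⟩
    (∂ f ⋆ g) (suc m) + (σ f ⋆ ∂ g) (suc m) ∎
    where
    I = qint Q m
    A = (shift f ⋆ g) m
    B = (∂ (shift f) ⋆ g) m
    C = (σ (shift f) ⋆ ∂ g) m
    shift-∂-term : A + Q * B ≈ (shift (∂ f) ⋆ g) m
    shift-∂-term = begin
      A + Q * B                                ≈⟨ +-congˡ (sym (⊙-⋆ Q (∂ (shift f)) g m)) ⟩
      A + ((Q ⊙ ∂ (shift f)) ⋆ g) m            ≈⟨ sym (⋆-distribʳ g (shift f) (Q ⊙ ∂ (shift f)) m) ⟩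
      ((shift f ⊕ Q ⊙ ∂ (shift f)) ⋆ g) m      ≈⟨ ⋆-congʳ g (λ j → sym (trans (*-congʳ (qint-suc Q j)) (+-*-split j))) m ⟩
      (shift (∂ f) ⋆ g) m                      ∎
      where
      +-*-split : ∀ j → (1# + Q * qint Q j) * f (suc j) ≈ f (suc j) + Q * (qint Q j * f (suc j))
      +-*-split j = solve 3 (λ Q I a → (con (1 , 0) :+ Q :* I) :* a := a :+ Q :* (I :* a)) refl Q (qint Q j) (f (suc j))
    shift-σ-term : Q * C ≈ (shift (σ f) ⋆ ∂ g) m
    shift-σ-term = trans (sym (⊙-⋆ Q (σ (shift f)) (∂ g) m))
                         (⋆-congʳ (∂ g) (λ j → sym (*-assoc Q (pow Q j) (f (suc j)))) m)

  σ-oneMinus : ∀ a → σ (oneMinus a) ≋ oneMinus (Q * a)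
  σ-oneMinus a zero = *-identityˡ _
  σ-oneMinus a (suc zero) = trans (*-congʳ (*-identityʳ Q)) (sym (-‿distribʳ-* Q a))
  σ-oneMinus a (suc (suc m)) = zeroʳ _

  ∂-oneMinus : ∀ a → ∂ (oneMinus a) ≋ ⊝ (const a ⋆ X)
  ∂-oneMinus a zero = trans (zeroˡ _) (sym (trans (-‿cong (trans (const-⋆ a X 0) (zeroʳ a))) -0#≈0#))
  ∂-oneMinus a (suc zero) = trans (*-congʳ (+-identityˡ _))
                              (trans (*-identityˡ _) (-‿cong (sym (trans (const-⋆ a X 1) (*-identityʳ a)))))
  ∂-oneMinus a (suc (suc m)) = trans (zeroʳ _) (sym (trans (-‿cong (trans (const-⋆ a X (suc (suc m))) (zeroʳ a))) -0#≈0#))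

  σ-oneS : σ oneS ≋ oneS
  σ-oneS zero = *-identityˡ _
  σ-oneS (suc m) = zeroʳ _

  ∂-oneS : ∂ oneS ≋ 0ₛ
  ∂-oneS zero = zeroˡ _
  ∂-oneS (suc m) = zeroʳ _


module Pochhammer {c ℓ} (R : CommutativeRing c ℓ) (Q : CommutativeRing.Carrier R) where
  open CommutativeRing R using (Carrier; _*_; 0#)
  open Alg R using (Series; _⋆_; oneS; oneMinus; poch; pow; qint)
  open PowerSeries R
  open QOperators R Q
  open CommutativeRing seriesRing using (sym; trans; refl; +-cong; +-congˡ; +-congʳ; -‿cong; setoid)
  open import Relation.Binary.Reasoning.Setoid setoid
  open IntegerSolver seriesRing using (solve; _:=_; _:+_; _:*_; :-_; con)

  poch-suc : ∀ N → poch Q (suc N) ≋ 1-X ⋆ σ (poch Q N)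
  poch-suc zero = trans (⋆-comm oneS 1-X) (⋆-congˡ 1-X (sym σ-oneS))
  poch-suc (suc N) = begin
    poch Q (suc N) ⋆ oneMinus (Q * pow Q N)               ≈⟨ ⋆-congʳ (oneMinus (Q * pow Q N)) (poch-suc N) ⟩
    (1-X ⋆ σ (poch Q N)) ⋆ oneMinus (Q * pow Q N)         ≈⟨ ⋆-assoc 1-X (σ (poch Q N)) (oneMinus (Q * pow Q N)) ⟩
    1-X ⋆ (σ (poch Q N) ⋆ oneMinus (Q * pow Q N))         ≈⟨ ⋆-congˡ 1-X (⋆-congˡ _ (sym (σ-oneMinus (pow Q N)))) ⟩
    1-X ⋆ (σ (poch Q N) ⋆ σ (oneMinus (pow Q N)))         ≈⟨ ⋆-congˡ 1-X (sym (σ-⋆ (poch Q N) (oneMinus (pow Q N)))) ⟩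
    1-X ⋆ σ (poch Q (suc N))                              ∎

  1-X⋆∂poch : ∀ N → 1-X ⋆ ∂ (poch Q N) ≋ ⊝ ((const (qint Q N) ⋆ X) ⋆ poch Q N)
  1-X⋆∂poch zero = begin
    1-X ⋆ ∂ oneS                  ≈⟨ ⋆-congˡ 1-X ∂-oneS ⟩
    1-X ⋆ 0ₛ                      ≈⟨ solve 3 (λ O A B → O :* con (0 , 0) := :- (con (0 , 0) :* A :* B)) refl 1-X X oneS ⟩
    ⊝ ((0ₛ ⋆ X) ⋆ oneS)           ≈⟨ -‿cong (⋆-congʳ oneS (⋆-congʳ X (sym const-0#))) ⟩
    ⊝ ((const 0# ⋆ X) ⋆ oneS)     ∎
  1-X⋆∂poch (suc N) = begin
    1-X ⋆ ∂ (p ⋆ o)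
      ≈⟨ ⋆-congˡ 1-X (trans (∂-⋆ p o) (+-congˡ (⋆-congˡ (σ p) (∂-oneMinus (pow Q N))))) ⟩
    1-X ⋆ (∂ p ⋆ o ⊕ σ p ⋆ (⊝ (const (pow Q N) ⋆ X)))
      ≈⟨ solve 6 (λ O dp o sp KQ X → O :* (dp :* o :+ sp :* (:- (KQ :* X))) := (O :* dp) :* o :+ :- ((O :* sp) :* KQ :* X)) refl 1-X (∂ p) o (σ p) (const (pow Q N)) X ⟩
    (1-X ⋆ ∂ p) ⋆ o ⊕ (⊝ (((1-X ⋆ σ p) ⋆ const (pow Q N)) ⋆ X))
      ≈⟨ +-cong (⋆-congʳ o (1-X⋆∂poch N)) (-‿cong (⋆-congʳ X (⋆-congʳ (const (pow Q N)) (sym (poch-suc N))))) ⟩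
    (⊝ ((const (qint Q N) ⋆ X) ⋆ p)) ⋆ o ⊕ (⊝ (((p ⋆ o) ⋆ const (pow Q N)) ⋆ X))
      ≈⟨ solve 5 (λ KN KQ X p o → :- (KN :* X :* p) :* o :+ :- ((p :* o) :* KQ :* X) := :- ((KN :+ KQ) :* X :* (p :* o))) refl (const (qint Q N)) (const (pow Q N)) X p o ⟩
    ⊝ (((const (qint Q N) ⊕ const (pow Q N)) ⋆ X) ⋆ (p ⋆ o))
      ≈⟨ -‿cong (⋆-congʳ (p ⋆ o) (⋆-congʳ X (sym (const-+ (qint Q N) (pow Q N))))) ⟩
    ⊝ ((const (qint Q (suc N)) ⋆ X) ⋆ (p ⋆ o)) ∎
    where
    p = poch Q N
    o = oneMinus (pow Q N)

  σ-⋆-poch : ∀ n G P → G ⋆ poch Q (suc n) ≋ P → σ G ⋆ poch Q (suc (suc n)) ≋ 1-X ⋆ σ P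
  σ-⋆-poch n G P G⋆π≋P = begin
    σ G ⋆ poch Q (suc (suc n))   ≈⟨ ⋆-congˡ (σ G) (poch-suc (suc n)) ⟩
    σ G ⋆ (1-X ⋆ σ π)            ≈⟨ solve 3 (λ a b c → a :* (b :* c) := b :* (a :* c)) refl (σ G) 1-X (σ π) ⟩
    1-X ⋆ (σ G ⋆ σ π)            ≈⟨ ⋆-congˡ 1-X (sym (σ-⋆ G π)) ⟩
    1-X ⋆ σ (G ⋆ π)              ≈⟨ ⋆-congˡ 1-X (σ-cong G⋆π≋P) ⟩
    1-X ⋆ σ P                    ∎
    where π = poch Q (suc n)

  ∂-⋆-poch : ∀ n G P → G ⋆ poch Q (suc n) ≋ P →
             ∂ G ⋆ poch Q (suc (suc n)) ≋ 1-X ⋆ ∂ P ⊕ (const (qint Q (suc n)) ⋆ X) ⋆ P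
  ∂-⋆-poch n G P G⋆π≋P = begin
    ∂ G ⋆ poch Q (suc (suc n))
      ≈⟨ ⋆-congˡ (∂ G) (poch-suc (suc n)) ⟩
    ∂ G ⋆ (1-X ⋆ σ π)
      ≈⟨ solve 4 (λ dG O sπ b → dG :* (O :* sπ) := O :* ((b :+ sπ :* dG) :+ :- b)) refl (∂ G) 1-X (σ π) (∂ π ⋆ G) ⟩
    1-X ⋆ ((∂ π ⋆ G ⊕ σ π ⋆ ∂ G) ⊕ (⊝ (∂ π ⋆ G)))
      ≈⟨ ⋆-congˡ 1-X (+-congʳ {⊝ (∂ π ⋆ G)} (sym (∂-⋆ π G))) ⟩
    1-X ⋆ (∂ (π ⋆ G) ⊕ (⊝ (∂ π ⋆ G)))
      ≈⟨ solve 4 (λ O a dπ G → O :* (a :+ :- (dπ :* G)) := O :* a :+ :- ((O :* dπ) :* G)) refl 1-X (∂ (π ⋆ G)) (∂ π) G ⟩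
    1-X ⋆ ∂ (π ⋆ G) ⊕ (⊝ ((1-X ⋆ ∂ π) ⋆ G))
      ≈⟨ +-cong (⋆-congˡ 1-X (∂-cong (trans (⋆-comm π G) G⋆π≋P))) (-‿cong (⋆-congʳ G (1-X⋆∂poch (suc n)))) ⟩
    1-X ⋆ ∂ P ⊕ (⊝ ((⊝ ((const (qint Q (suc n)) ⋆ X) ⋆ π)) ⋆ G))
      ≈⟨ +-congˡ (solve 3 (λ KX p G → :- ((:- (KX :* p)) :* G) := KX :* (G :* p)) refl (const (qint Q (suc n)) ⋆ X) π G) ⟩
    1-X ⋆ ∂ P ⊕ (const (qint Q (suc n)) ⋆ X) ⋆ (G ⋆ π)
      ≈⟨ +-congˡ (⋆-congˡ (const (qint Q (suc n)) ⋆ X) G⋆π≋P) ⟩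
    1-X ⋆ ∂ P ⊕ (const (qint Q (suc n)) ⋆ X) ⋆ P ∎
    where π = poch Q (suc n)

sumℕ : List ℕ → ℕ
sumℕ = List.foldr ℕ._+_ 0

bit : Bool → ℕ
bit b = if b then 1 else 0

bit≤1 : ∀ b → bit b ℕ.≤ 1
bit≤1 true = ℕ.s≤s ℕ.z≤n
bit≤1 false = ℕ.z≤n

slot-count : ∀ L b a b′ D′ s s′ → suc (suc L) ≡ b ℕ.+ (a ℕ.+ D′) ℕ.+ s → suc L ≡ b′ ℕ.+ D′ ℕ.+ s′ →
             b ℕ.+ a ℕ.+ s ≡ suc (b′ ℕ.+ s′)
slot-count L b a b′ D′ s s′ h h′ = ℕₚ.+-cancelˡ-≡ D′ _ _ (begin
  D′ ℕ.+ (b ℕ.+ a ℕ.+ s)    ≡⟨ +-*-Solver.solve 4 (λ b a d s → d :+ (b :+ a :+ s) := b :+ (a :+ d) :+ s) ≡.refl b a D′ s ⟩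
  b ℕ.+ (a ℕ.+ D′) ℕ.+ s    ≡⟨ h ⟨
  suc (suc L)               ≡⟨ ≡.cong suc h′ ⟩
  suc (b′ ℕ.+ D′ ℕ.+ s′)    ≡⟨ +-*-Solver.solve 3 (λ b d s → con 1 :+ (b :+ d :+ s) := d :+ (con 1 :+ (b :+ s))) ≡.refl b′ D′ s′ ⟩
  D′ ℕ.+ suc (b′ ℕ.+ s′)    ∎)
  where
  open ≡.≡-Reasoning
  open +-*-Solver using (_:=_; _:+_; con)

inserts : ∀ {A : Set} → A → List A → List (List A)
inserts z [] = (z ∷ []) ∷ []
inserts z (y ∷ ys) = (z ∷ y ∷ ys) ∷ List.map (y ∷_) (inserts z ys)

map-inserts : ∀ {A B : Set} (f : A → B) z l → List.map (List.map f) (inserts z l) ≡ inserts (f z) (List.map f l)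
map-inserts f z [] = ≡.refl
map-inserts f z (y ∷ ys) = ≡.cong ((f z ∷ f y ∷ List.map f ys) ∷_)
  (≡.trans (≡.sym (Listₚ.map-∘ (inserts z ys))) (≡.trans (Listₚ.map-∘ (inserts z ys)) (≡.cong (List.map (f y ∷_)) (map-inserts f z ys))))

module Descents {A : Set} (_≺_ : A → A → Bool) where

  descentsFrom : ℕ → List A → List ℕ
  descentsFrom i (x ∷ r@(y ∷ _)) = (if y ≺ x then i ∷ [] else []) ++ descentsFrom (suc i) r
  descentsFrom i _ = []

  ndes : List A → ℕ
  ndes l = length (descentsFrom 0 l)

  majorIndex : List A → ℕ
  majorIndex l = sumℕ (descentsFrom 0 l)

  private
    length-opt : ∀ (b : Bool) i (xs : List ℕ) → length ((if b then i ∷ [] else []) ++ xs) ≡ bit b ℕ.+ length xs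
    length-opt true i xs = ≡.refl
    length-opt false i xs = ≡.refl

    sum-opt : ∀ (b : Bool) i (xs : List ℕ) → sumℕ ((if b then i ∷ [] else []) ++ xs) ≡ (if b then i else 0) ℕ.+ sumℕ xs
    sum-opt true i xs = ≡.refl
    sum-opt false i xs = ≡.refl

  length-descentsFrom-suc : ∀ i l → length (descentsFrom (suc i) l) ≡ length (descentsFrom i l)
  length-descentsFrom-suc i [] = ≡.refl
  length-descentsFrom-suc i (x ∷ []) = ≡.refl
  length-descentsFrom-suc i (x ∷ r@(y ∷ _)) = begin
    length (descentsFrom (suc i) (x ∷ r))                  ≡⟨ length-opt (y ≺ x) (suc i) _ ⟩
    bit (y ≺ x) ℕ.+ length (descentsFrom (suc (suc i)) r)  ≡⟨ ≡.cong (bit (y ≺ x) ℕ.+_) (length-descentsFrom-suc (suc i) r) ⟩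
    bit (y ≺ x) ℕ.+ length (descentsFrom (suc i) r)        ≡⟨ length-opt (y ≺ x) i _ ⟨
    length (descentsFrom i (x ∷ r))                        ∎
    where open ≡.≡-Reasoning

  sum-descentsFrom-suc : ∀ i l → sumℕ (descentsFrom (suc i) l) ≡ sumℕ (descentsFrom i l) ℕ.+ length (descentsFrom i l)
  sum-descentsFrom-suc i [] = ≡.refl
  sum-descentsFrom-suc i (x ∷ []) = ≡.refl
  sum-descentsFrom-suc i (x ∷ r@(y ∷ _)) = begin
    sumℕ (descentsFrom (suc i) (x ∷ r))
      ≡⟨ sum-opt (y ≺ x) (suc i) _ ⟩
    (if y ≺ x then suc i else 0) ℕ.+ sumℕ (descentsFrom (suc (suc i)) r)
      ≡⟨ ≡.cong ((if y ≺ x then suc i else 0) ℕ.+_) (sum-descentsFrom-suc (suc i) r) ⟩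
    (if y ≺ x then suc i else 0) ℕ.+ (sumℕ (descentsFrom (suc i) r) ℕ.+ length (descentsFrom (suc i) r))
      ≡⟨ regroup (y ≺ x) _ _ ⟩
    ((if y ≺ x then i else 0) ℕ.+ sumℕ (descentsFrom (suc i) r)) ℕ.+ (bit (y ≺ x) ℕ.+ length (descentsFrom (suc i) r))
      ≡⟨ ≡.cong₂ ℕ._+_ (sum-opt (y ≺ x) i _) (length-opt (y ≺ x) i _) ⟨
    sumℕ (descentsFrom i (x ∷ r)) ℕ.+ length (descentsFrom i (x ∷ r)) ∎
    where
    open ≡.≡-Reasoning
    regroup : ∀ (b : Bool) s l → (if b then suc i else 0) ℕ.+ (s ℕ.+ l) ≡ ((if b then i else 0) ℕ.+ s) ℕ.+ (bit b ℕ.+ l)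
    regroup true s l = ≡.trans (≡.cong suc (≡.sym (ℕₚ.+-assoc i s l))) (≡.sym (ℕₚ.+-suc (i ℕ.+ s) l))
    regroup false s l = ≡.refl

  length-descentsFrom≤ : ∀ i y r → length (descentsFrom i (y ∷ r)) ℕ.≤ length r
  length-descentsFrom≤ i y [] = ℕ.z≤n
  length-descentsFrom≤ i y (y′ ∷ r) =
    ≡.subst (ℕ._≤ suc (length r)) (≡.sym (length-opt (y′ ≺ y) i _)) (bit+≤ (y′ ≺ y) (length-descentsFrom≤ (suc i) y′ r))
    where
    bit+≤ : ∀ b {k} → k ℕ.≤ length r → bit b ℕ.+ k ℕ.≤ suc (length r)
    bit+≤ true h = ℕ.s≤s h
    bit+≤ false h = ℕₚ.m≤n⇒m≤1+n h

  majorIndex-∷ : ∀ x y l → majorIndex (x ∷ y ∷ l) ≡ majorIndex (y ∷ l) ℕ.+ ndes (y ∷ l)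
  majorIndex-∷ x y l with y ≺ x
  ... | true = sum-descentsFrom-suc 0 (y ∷ l)
  ... | false = sum-descentsFrom-suc 0 (y ∷ l)

  ndes-∷ : ∀ x y l → ndes (x ∷ y ∷ l) ≡ bit (y ≺ x) ℕ.+ ndes (y ∷ l)
  ndes-∷ x y l = ≡.trans (length-opt (y ≺ x) 0 _) (≡.cong (bit (y ≺ x) ℕ.+_) (length-descentsFrom-suc 0 (y ∷ l)))

-- Inserting a letter z into every slot after the first letter e of a word:
-- the slots can be ordered so that the k-th one raises maj by k, and the
-- descent number by 1 exactly from the (b + ndes)-th slot on, b = [e ≺ z].
module Insertion {c ℓ} (R : CommutativeRing c ℓ) {A : Set} (_≺_ : A → A → Bool)
  (≺-trans : ∀ {x y z} → x ≺ y ≡ true → y ≺ z ≡ true → x ≺ z ≡ true)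
  (≺-irrefl : ∀ x → x ≺ x ≡ false) where
  open import Data.List.Relation.Unary.All using (All; []; _∷_)
  open import Data.Empty using (⊥; ⊥-elim)
  open CommutativeRing R
  open Alg R
  open AlgProperties R
  open Descents _≺_ public
  open import Relation.Binary.Reasoning.Setoid setoid
  open IntegerSolver R using (solve; _:=_; _:+_; _:*_; con)

  ≺-asym : ∀ {x y} → x ≺ y ≡ true → y ≺ x ≡ false
  ≺-asym {x} {y} x≺y with y ≺ x in y≺x
  ... | false = ≡.refl
  ... | true with () ← ≡.trans (≡.sym (≺-trans x≺y y≺x)) (≺-irrefl x)

  ComparableTo : A → List A → Set
  ComparableTo z = All (λ y → y ≺ z ≡ false → z ≺ y ≡ true)

  ≺-flip : ∀ {y z} → (y ≺ z ≡ false → z ≺ y ≡ true) → z ≺ y ≡ not (y ≺ z)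
  ≺-flip {y} {z} total with y ≺ z in y≺z
  ... | true = ≺-asym y≺z
  ... | false = total ≡.refl

  weight : Carrier → Carrier → List A → Carrier
  weight Q x l = pow x (ndes l) * pow Q (majorIndex l)

  weight-∷ : ∀ Q x e y l → weight Q x (e ∷ y ∷ l) ≈ pow x (bit (y ≺ e)) * weight Q (x * Q) (y ∷ l)
  weight-∷ Q x e y l = begin
    weight Q x (e ∷ y ∷ l)                     ≡⟨ ≡.cong₂ (λ d m → pow x d * pow Q m) (ndes-∷ e y l) (majorIndex-∷ e y l) ⟩
    pow x (b ℕ.+ d) * pow Q (m ℕ.+ d)          ≈⟨ *-cong (pow-+ x b d) (pow-+ Q m d) ⟩
    (pow x b * pow x d) * (pow Q m * pow Q d)  ≈⟨ solve 4 (λ xb xd Qm Qd → (xb :* xd) :* (Qm :* Qd) := xb :* ((xd :* Qd) :* Qm)) refl _ _ _ _ ⟩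
    pow x b * ((pow x d * pow Q d) * pow Q m)  ≈⟨ *-congˡ (*-congʳ (sym (pow-* x Q d))) ⟩
    pow x b * weight Q (x * Q) (y ∷ l)         ∎
    where
    b = bit (y ≺ e)
    d = ndes (y ∷ l)
    m = majorIndex (y ∷ l)

  weight-scale : ∀ Q y l → weight Q (y * Q) l ≈ weight Q y l * pow Q (ndes l)
  weight-scale Q y l = trans (*-congʳ (pow-* y Q (ndes l))) (solve 3 (λ a b c → a :* b :* c := a :* c :* b) refl _ _ _)

  sumList-weight-∷∷ : ∀ Q x e y L → sumList (weight Q x) (List.map (e ∷_) (List.map (y ∷_) L))
                                    ≈ pow x (bit (y ≺ e)) * sumList (weight Q (x * Q)) (List.map (y ∷_) L)
  sumList-weight-∷∷ Q x e y [] = sym (zeroʳ _)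
  sumList-weight-∷∷ Q x e y (l ∷ L) = trans (+-cong (weight-∷ Q x e y l) (sumList-weight-∷∷ Q x e y L)) (sym (distribˡ _ _ _))

  private
    -- The induction step of insertion-sum as an identity in R, one case for
    -- each consistent choice of a = [e₁ ≺ e₀], b = [e₀ ≺ z], b′ = [e₁ ≺ z].
    step-identity : ∀ x Q W D′ s s′ (a b b′ b̄ : Bool) → b̄ ≡ not b →
      (a ≡ false → b ≡ false → b′ ≡ true → ⊥) → (a ≡ true → b ≡ true → b′ ≡ false → ⊥) →
      bit b ℕ.+ bit a ℕ.+ s ≡ suc (bit b′ ℕ.+ s′) →
      pow x (bit b̄) * (pow (x * Q) (bit b′) * (W * pow Q D′))
        + pow x (bit a) * (W * (qint Q (bit b′ ℕ.+ D′) + (x * Q) * pow Q (bit b′ ℕ.+ D′) * qint Q s′))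
      ≈ (pow x (bit a) * W) * (qint Q (bit b ℕ.+ (bit a ℕ.+ D′)) + x * pow Q (bit b ℕ.+ (bit a ℕ.+ D′)) * qint Q s)
    step-identity x Q W D′ s s′ false false false .true ≡.refl _ _ e with ≡.refl ← e =
      trans (solve 6 (λ x Q W QD I J → x :* con (1 , 0) :* (con (1 , 0) :* (W :* QD)) :+ con (1 , 0) :* (W :* (I :+ (x :* Q) :* QD :* J))
                                    := (con (1 , 0) :* W) :* (I :+ x :* QD :* (con (1 , 0) :+ Q :* J))) refl x Q W (pow Q D′) (qint Q D′) (qint Q s′))
            (sym (*-congˡ (+-congˡ (*-congˡ (qint-suc Q s′)))))
    step-identity x Q W D′ s s′ false false true .true ≡.refl i _ e = ⊥-elim (i ≡.refl ≡.refl ≡.refl)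
    step-identity x Q W D′ s s′ false true false .false ≡.refl _ _ e with ≡.refl ← ℕₚ.suc-injective e =
      solve 6 (λ x Q W QD I J → con (1 , 0) :* (con (1 , 0) :* (W :* QD)) :+ con (1 , 0) :* (W :* (I :+ (x :* Q) :* QD :* J))
                              := (con (1 , 0) :* W) :* ((I :+ QD) :+ x :* (Q :* QD) :* J)) refl x Q W (pow Q D′) (qint Q D′) (qint Q s′)
    step-identity x Q W D′ s s′ false true true .false ≡.refl _ _ e with ≡.refl ← ℕₚ.suc-injective e =
      trans (solve 6 (λ x Q W QD I J → con (1 , 0) :* ((x :* Q) :* con (1 , 0) :* (W :* QD)) :+ con (1 , 0) :* (W :* ((I :+ QD) :+ (x :* Q) :* (Q :* QD) :* J))
                                    := (con (1 , 0) :* W) :* ((I :+ QD) :+ x :* (Q :* QD) :* (con (1 , 0) :+ Q :* J))) refl x Q W (pow Q D′) (qint Q D′) (qint Q s′))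
            (sym (*-congˡ (+-congˡ (*-congˡ (qint-suc Q s′)))))
    step-identity x Q W D′ s s′ true false false .true ≡.refl _ _ e with ≡.refl ← ℕₚ.suc-injective e =
      solve 6 (λ x Q W QD I J → x :* con (1 , 0) :* (con (1 , 0) :* (W :* QD)) :+ x :* con (1 , 0) :* (W :* (I :+ (x :* Q) :* QD :* J))
                              := (x :* con (1 , 0) :* W) :* ((I :+ QD) :+ x :* (Q :* QD) :* J)) refl x Q W (pow Q D′) (qint Q D′) (qint Q s′)
    step-identity x Q W D′ s s′ true false true .true ≡.refl _ _ e with ≡.refl ← ℕₚ.suc-injective e =
      trans (solve 6 (λ x Q W QD I J → x :* con (1 , 0) :* ((x :* Q) :* con (1 , 0) :* (W :* QD)) :+ x :* con (1 , 0) :* (W :* ((I :+ QD) :+ (x :* Q) :* (Q :* QD) :* J))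
                                    := (x :* con (1 , 0) :* W) :* ((I :+ QD) :+ x :* (Q :* QD) :* (con (1 , 0) :+ Q :* J))) refl x Q W (pow Q D′) (qint Q D′) (qint Q s′))
            (sym (*-congˡ (+-congˡ (*-congˡ (qint-suc Q s′)))))
    step-identity x Q W D′ s s′ true true false .false ≡.refl _ i e = ⊥-elim (i ≡.refl ≡.refl ≡.refl)
    step-identity x Q W D′ s s′ true true true .false ≡.refl _ _ e with ≡.refl ← ℕₚ.suc-injective (ℕₚ.suc-injective e) =
      solve 6 (λ x Q W QD I J → con (1 , 0) :* ((x :* Q) :* con (1 , 0) :* (W :* QD)) :+ x :* con (1 , 0) :* (W :* ((I :+ QD) :+ (x :* Q) :* (Q :* QD) :* J))
                              := (x :* con (1 , 0) :* W) :* (((I :+ QD) :+ Q :* QD) :+ x :* (Q :* (Q :* QD)) :* J)) refl x Q W (pow Q D′) (qint Q D′) (qint Q s′)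

    base-identity : ∀ x Q s (b b̄ : Bool) → b̄ ≡ not b → 1 ≡ bit b ℕ.+ 0 ℕ.+ s →
      pow x (bit b̄) * (pow (x * Q) 0 * pow Q 0) + 0# ≈ (pow x 0 * pow Q 0) * (qint Q (bit b ℕ.+ 0) + x * pow Q (bit b ℕ.+ 0) * qint Q s)
    base-identity x Q zero true .false ≡.refl ≡.refl =
      solve 2 (λ x Q → con (1 , 0) :* (con (1 , 0) :* con (1 , 0)) :+ con (0 , 0)
                     := (con (1 , 0) :* con (1 , 0)) :* ((con (0 , 0) :+ con (1 , 0)) :+ x :* (Q :* con (1 , 0)) :* con (0 , 0))) refl x Q
    base-identity x Q (suc zero) false .true ≡.refl ≡.refl =
      solve 2 (λ x Q → x :* con (1 , 0) :* (con (1 , 0) :* con (1 , 0)) :+ con (0 , 0)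
                     := (con (1 , 0) :* con (1 , 0)) :* (con (0 , 0) :+ x :* con (1 , 0) :* (con (0 , 0) :+ con (1 , 0)))) refl x Q

  insertion-sum : ∀ z Q x e rest s → ComparableTo z (e ∷ rest) →
    suc (length rest) ≡ bit (e ≺ z) ℕ.+ ndes (e ∷ rest) ℕ.+ s →
    sumList (weight Q x) (List.map (e ∷_) (inserts z rest))
    ≈ weight Q x (e ∷ rest) * (qint Q (bit (e ≺ z) ℕ.+ ndes (e ∷ rest)) + x * pow Q (bit (e ≺ z) ℕ.+ ndes (e ∷ rest)) * qint Q s)
  insertion-sum z Q x e [] s (t ∷ []) hs =
    trans (+-congʳ (weight-∷ Q x e z [])) (base-identity x Q s (e ≺ z) (z ≺ e) (≺-flip t) hs)
  insertion-sum z Q x e₀ (e₁ ∷ r) s (t₀ ∷ t₁ ∷ ts) hs = begin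
    weight Q x (e₀ ∷ z ∷ e₁ ∷ r) + sumList (weight Q x) (List.map (e₀ ∷_) (List.map (e₁ ∷_) (inserts z r)))
      ≈⟨ +-cong (trans (weight-∷ Q x e₀ z (e₁ ∷ r)) (*-congˡ (trans (weight-∷ Q (x * Q) z e₁ r) (*-congˡ (weight-scale Q (x * Q) (e₁ ∷ r))))))
                (trans (sumList-weight-∷∷ Q x e₀ e₁ (inserts z r)) (*-congˡ IH)) ⟩
    pow x c₀ * (pow (x * Q) b′ * (W * pow Q D′)) + pow x a * (W * (qint Q (b′ ℕ.+ D′) + (x * Q) * pow Q (b′ ℕ.+ D′) * qint Q s′))
      ≈⟨ step-identity x Q W D′ s s′ (e₁ ≺ e₀) (e₀ ≺ z) (e₁ ≺ z) (z ≺ e₀) (≺-flip t₀) no-dip no-peak count ⟩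
    (pow x a * W) * (qint Q (b ℕ.+ (a ℕ.+ D′)) + x * pow Q (b ℕ.+ (a ℕ.+ D′)) * qint Q s)
      ≈⟨ *-cong (sym (weight-∷ Q x e₀ e₁ r)) (reflexive (≡.cong (λ k → qint Q (b ℕ.+ k) + x * pow Q (b ℕ.+ k) * qint Q s) (≡.sym (ndes-∷ e₀ e₁ r)))) ⟩
    weight Q x (e₀ ∷ e₁ ∷ r) * (qint Q (b ℕ.+ ndes (e₀ ∷ e₁ ∷ r)) + x * pow Q (b ℕ.+ ndes (e₀ ∷ e₁ ∷ r)) * qint Q s) ∎
    where
    D′ = ndes (e₁ ∷ r)
    W = weight Q (x * Q) (e₁ ∷ r)
    a = bit (e₁ ≺ e₀)
    b = bit (e₀ ≺ z)
    b′ = bit (e₁ ≺ z)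
    c₀ = bit (z ≺ e₀)
    s′ = suc (length r) ∸ (b′ ℕ.+ D′)
    hs′ : suc (length r) ≡ b′ ℕ.+ D′ ℕ.+ s′
    hs′ = ≡.sym (ℕₚ.m+[n∸m]≡n (ℕₚ.+-mono-≤ (bit≤1 (e₁ ≺ z)) (length-descentsFrom≤ 0 e₁ r)))
    IH = insertion-sum z Q (x * Q) e₁ r s′ (t₁ ∷ ts) hs′
    count : b ℕ.+ a ℕ.+ s ≡ suc (b′ ℕ.+ s′)
    count = slot-count (length r) b a b′ D′ s s′ (≡.trans hs (≡.cong (λ k → b ℕ.+ k ℕ.+ s) (ndes-∷ e₀ e₁ r))) hs′
    no-dip : e₁ ≺ e₀ ≡ false → e₀ ≺ z ≡ false → e₁ ≺ z ≡ true → ⊥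
    no-dip e₁⊀e₀ e₀⊀z e₁≺z with () ← ≡.trans (≡.sym (≺-trans e₁≺z (t₀ e₀⊀z))) e₁⊀e₀
    no-peak : e₁ ≺ e₀ ≡ true → e₀ ≺ z ≡ true → e₁ ≺ z ≡ false → ⊥
    no-peak e₁≺e₀ e₀≺z e₁⊀z with () ← ≡.trans (≡.sym (≺-trans e₁≺e₀ e₀≺z)) e₁⊀z

module Enumeration where
  open import Data.Fin as Fin using (Fin; zero; suc; fromℕ; inject₁)
  import Data.Fin.Properties as Finₚ
  open import Data.Product using (Σ; ∃)
  open import Data.Sum using (_⊎_; inj₁; inj₂)
  open import Data.Empty using (⊥; ⊥-elim)
  open import Data.List using (concatMap)
  open import Data.Vec using ([]; _∷_)
  open import Data.List.Membership.Propositional using (_∈_; find)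
  open import Data.List.Membership.Propositional.Properties using (∈-map⁺; ∈-map⁻; ∈-concatMap⁺; ∈-concatMap⁻)
  open import Data.List.Relation.Unary.Any as Any using (here; there)
  import Data.List.Relation.Unary.All as All
  open import Data.List.Relation.Unary.Unique.Propositional using (Unique)
  import Data.List.Relation.Unary.Unique.Propositional.Properties as Uniqueₚ
  import Data.List.Relation.Unary.AllPairs as AllPairs
  import Data.Vec.Membership.Propositional as Vec∈
  import Data.Vec.Membership.Propositional.Properties as Vec∈ₚ
  import Data.Vec.Relation.Unary.Any as VecAny
  import Data.Vec.Relation.Unary.Any.Properties as VecAnyₚ
  open ≡ using (refl; cong; cong₂; subst; sym; trans)
  open import Relation.Nullary using (¬_; yes; no)

  ∈-concatMap-intro : ∀ {A B : Set} (g : A → List B) {a b xs} → a ∈ xs → b ∈ g a → b ∈ concatMap g xs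
  ∈-concatMap-intro g a∈xs b∈ga = ∈-concatMap⁺ g (Any.map (λ { refl → b∈ga }) a∈xs)

  ∈-concatMap-elim : ∀ {A B : Set} (g : A → List B) {b} xs → b ∈ concatMap g xs → ∃ λ a → a ∈ xs × b ∈ g a
  ∈-concatMap-elim g xs b∈ = find (∈-concatMap⁻ g b∈)

  -- The blocks g a are unique and disjoint because r recovers a from any b ∈ g a.
  concatMap-unique : ∀ {A B : Set} (g : A → List B) (r : B → A) xs → Unique xs →
    (∀ a → a ∈ xs → Unique (g a)) → (∀ a b → a ∈ xs → b ∈ g a → r b ≡ a) → Unique (concatMap g xs)
  concatMap-unique g r [] _ _ _ = AllPairs.[]
  concatMap-unique g r (x ∷ xs) (x∉xs AllPairs.∷ xs!) g! r-inv =
    Uniqueₚ.++⁺ (g! x (here refl))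
                (concatMap-unique g r xs xs! (λ a a∈ → g! a (there a∈)) (λ a b a∈ → r-inv a b (there a∈)))
                disjoint
    where
    disjoint : ∀ {v} → ¬ (v ∈ g x × v ∈ concatMap g xs)
    disjoint (v∈gx , v∈rest) with ∈-concatMap-elim g xs v∈rest
    ... | a , a∈xs , v∈ga = All.lookup x∉xs a∈xs (trans (sym (r-inv x _ (here refl) v∈gx)) (r-inv a _ (there a∈xs) v∈ga))

  vec-∈-map⁻ : ∀ {A B : Set} (f : A → B) {m y} (v : Vec A m) → y Vec∈.∈ Vec.map f v → ∃ λ x → x Vec∈.∈ v × y ≡ f x
  vec-∈-map⁻ f v y∈ = Vec∈.find (VecAnyₚ.map⁻ y∈)

  surjective⇒≤ : ∀ {N m} (v : Vec (Fin N) m) → (∀ i → i Vec∈.∈ v) → N ℕ.≤ m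
  surjective⇒≤ {N} {m} v hit with m ℕ.<? N
  ... | no m≮N = ℕₚ.≮⇒≥ m≮N
  ... | yes m<N with Finₚ.pigeonhole m<N (λ i → VecAny.index (hit i))
  ... | i , j , i<j , same = ⊥-elim (Finₚ.<⇒≢ i<j (trans (lookup-index (hit i))
                                                   (trans (cong (Vec.lookup v) same) (sym (lookup-index (hit j))))))
    where open VecAnyₚ using (lookup-index)

  insertsᵛ : ∀ {A : Set} {m} → A → Vec A m → List (Vec A (suc m))
  insertsᵛ z [] = (z ∷ []) ∷ []
  insertsᵛ z (y ∷ ys) = (z ∷ y ∷ ys) ∷ List.map (y ∷_) (insertsᵛ z ys)

  module _ {A : Set} where
    ∈-insertsᵛ-new : ∀ {m} {z : A} (v : Vec A m) {u} → u ∈ insertsᵛ z v → z Vec∈.∈ u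
    ∈-insertsᵛ-new [] (here refl) = VecAny.here refl
    ∈-insertsᵛ-new (y ∷ ys) (here refl) = VecAny.here refl
    ∈-insertsᵛ-new (y ∷ ys) (there p) with ∈-map⁻ (y ∷_) p
    ... | u′ , p′ , refl = VecAny.there (∈-insertsᵛ-new ys p′)

    ∈-insertsᵛ-old : ∀ {m} {z x : A} (v : Vec A m) {u} → u ∈ insertsᵛ z v → x Vec∈.∈ v → x Vec∈.∈ u
    ∈-insertsᵛ-old (y ∷ ys) (here refl) x∈ = VecAny.there x∈
    ∈-insertsᵛ-old (y ∷ ys) (there p) x∈ with ∈-map⁻ (y ∷_) p | x∈
    ... | u′ , p′ , refl | VecAny.here refl = VecAny.here refl
    ... | u′ , p′ , refl | VecAny.there x∈ys = VecAny.there (∈-insertsᵛ-old ys p′ x∈ys)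

    ∈-insertsᵛ⁻ : ∀ {m} {z x : A} (v : Vec A m) {u} → u ∈ insertsᵛ z v → x Vec∈.∈ u → x ≡ z ⊎ x Vec∈.∈ v
    ∈-insertsᵛ⁻ [] (here refl) (VecAny.here refl) = inj₁ refl
    ∈-insertsᵛ⁻ (y ∷ ys) (here refl) (VecAny.here refl) = inj₁ refl
    ∈-insertsᵛ⁻ (y ∷ ys) (here refl) (VecAny.there x∈) = inj₂ x∈
    ∈-insertsᵛ⁻ (y ∷ ys) (there p) x∈ with ∈-map⁻ (y ∷_) p | x∈
    ... | u′ , p′ , refl | VecAny.here refl = inj₂ (VecAny.here refl)
    ... | u′ , p′ , refl | VecAny.there x∈u′ with ∈-insertsᵛ⁻ ys p′ x∈u′
    ...   | inj₁ x≡z = inj₁ x≡z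
    ...   | inj₂ x∈ys = inj₂ (VecAny.there x∈ys)

    insertsᵛ-unique : ∀ {m} {z : A} (v : Vec A m) → ¬ (z Vec∈.∈ v) → Unique (insertsᵛ z v)
    insertsᵛ-unique [] _ = All.[] AllPairs.∷ AllPairs.[]
    insertsᵛ-unique {z = z} (y ∷ ys) z∉ = head-new AllPairs.∷ Uniqueₚ.map⁺ ∷-injectiveʳ (insertsᵛ-unique ys (z∉ ∘ VecAny.there))
      where
      ∷-injectiveʳ : ∀ {a b : Vec A _} → y ∷ a ≡ y ∷ b → a ≡ b
      ∷-injectiveʳ refl = refl
      head-new : All.All (λ w → (z ∷ y ∷ ys) ≢ w) (List.map (y ∷_) (insertsᵛ z ys))
      head-new = All.tabulate λ w∈ eq → case w∈ eq
        where
        case : ∀ {w} → w ∈ List.map (y ∷_) (insertsᵛ z ys) → (z ∷ y ∷ ys) ≡ w → ⊥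
        case w∈ eq with ∈-map⁻ (y ∷_) w∈
        case w∈ refl | u′ , _ , refl = z∉ (VecAny.here refl)

  top : ∀ {n} → Fin (suc n)
  top {n} = fromℕ n

  liftLetter : ∀ {n} → Letter n → Letter (suc n)
  liftLetter (a , c) = (inject₁ a , c)

  liftWord : ∀ {n m} → Vec (Letter n) m → Vec (Letter (suc n)) m
  liftWord = Vec.map liftLetter

  -- Left inverse of inject₁ (top is sent anywhere).
  lower : ∀ {n} → Fin (suc (suc n)) → Fin (suc n)
  lower zero = zero
  lower {zero} (suc i) = zero
  lower {suc n} (suc i) = suc (lower i)

  lower-inject₁ : ∀ {n} (j : Fin (suc n)) → lower (inject₁ j) ≡ j
  lower-inject₁ zero = refl
  lower-inject₁ {suc n} (suc j) = cong suc (lower-inject₁ j)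

  inject₁-lower : ∀ {n} (i : Fin (suc (suc n))) → i ≢ top → inject₁ (lower i) ≡ i
  inject₁-lower zero _ = refl
  inject₁-lower {zero} (suc zero) i≢top = ⊥-elim (i≢top refl)
  inject₁-lower {suc n} (suc i) i≢top = cong suc (inject₁-lower i (i≢top ∘ cong suc))

  lowerWord : ∀ {n} → Vec (Letter (suc n)) n → Vec (Letter n) n
  lowerWord {zero} [] = []
  lowerWord {suc n} v = Vec.map (λ (a , c) → (lower a , c)) v

  lowerWord-liftWord : ∀ {n} (u : Vec (Letter n) n) → lowerWord (liftWord u) ≡ u
  lowerWord-liftWord {zero} [] = refl
  lowerWord-liftWord {suc n} u =
    trans (sym (Vecₚ.map-∘ _ _ u)) (trans (Vecₚ.map-cong (λ (a , c) → cong (_, c) (lower-inject₁ a)) u) (Vecₚ.map-id u))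

  liftWord-lowerWord : ∀ {n} (u : Vec (Letter (suc n)) n) → (∀ y → y Vec∈.∈ u → proj₁ y ≢ top) → liftWord (lowerWord u) ≡ u
  liftWord-lowerWord {zero} [] _ = refl
  liftWord-lowerWord {suc n} u no-top = trans (sym (Vecₚ.map-∘ _ _ u)) (go u no-top)
    where
    go : ∀ {m} (v : Vec (Letter (suc (suc n))) m) → (∀ y → y Vec∈.∈ v → proj₁ y ≢ top) →
         Vec.map (liftLetter ∘ λ (a , c) → (lower a , c)) v ≡ v
    go [] _ = refl
    go ((a , c) ∷ v) no-top = cong₂ _∷_ (cong (_, c) (inject₁-lower a (no-top _ (VecAny.here refl))))
                                        (go v (λ y y∈ → no-top y (VecAny.there y∈)))

  liftWord-no-top : ∀ {n m} (u : Vec (Letter n) m) → ∀ y → y Vec∈.∈ liftWord u → proj₁ y ≢ top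
  liftWord-no-top u y y∈ y≡top with vec-∈-map⁻ liftLetter u y∈
  ... | (a , c) , _ , refl = Finₚ.fromℕ≢inject₁ (sym y≡top)

  isTop : ∀ {n} → Fin (suc n) → Bool
  isTop {zero} zero = true
  isTop {suc n} zero = false
  isTop {suc n} (suc i) = isTop i

  isTop-top : ∀ n → isTop (fromℕ n) ≡ true
  isTop-top zero = refl
  isTop-top (suc n) = isTop-top n

  isTop-inject₁ : ∀ {n} (j : Fin n) → isTop (inject₁ j) ≡ false
  isTop-inject₁ {suc n} zero = refl
  isTop-inject₁ {suc n} (suc j) = isTop-inject₁ j

  removeTop : ∀ {n m} → Vec (Letter (suc n)) (suc m) → Vec (Letter (suc n)) m
  removeTop {m = zero} (y ∷ []) = []
  removeTop {m = suc m} (y ∷ ys) = if isTop (proj₁ y) then ys else y ∷ removeTop ys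

  colourOfTop : ∀ {n m} → Vec (Letter (suc n)) m → Bool
  colourOfTop [] = false
  colourOfTop (y ∷ ys) = if isTop (proj₁ y) then proj₂ y else colourOfTop ys

  removeTop-insertsᵛ : ∀ {n m} c (w : Vec (Letter n) m) {u} → u ∈ insertsᵛ (top , c) (liftWord w) →
                       removeTop u ≡ liftWord w × colourOfTop u ≡ c
  removeTop-insertsᵛ {n} c [] (here refl) rewrite isTop-top n = refl , refl
  removeTop-insertsᵛ {n} c (y ∷ ys) (here refl) rewrite isTop-top n = refl , refl
  removeTop-insertsᵛ {n} c (y ∷ ys) (there p) with ∈-map⁻ (liftLetter y ∷_) p
  ... | u′ , p′ , refl with removeTop-insertsᵛ c ys p′
  ... | removed , coloured = remove-∷ ys u′ removed , colour-∷
    where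
    remove-∷ : ∀ {m} (ys : Vec _ m) (u′ : Vec _ (suc m)) → removeTop u′ ≡ liftWord ys →
               removeTop (liftLetter y ∷ u′) ≡ liftLetter y ∷ liftWord ys
    remove-∷ [] (x ∷ []) _ rewrite isTop-inject₁ (proj₁ y) = refl
    remove-∷ (_ ∷ _) u′ e rewrite isTop-inject₁ (proj₁ y) = cong (liftLetter y ∷_) e
    colour-∷ : colourOfTop (liftLetter y ∷ u′) ≡ c
    colour-∷ rewrite isTop-inject₁ (proj₁ y) = coloured

  withColours : ∀ {X : Set} → List X → List (X × Bool)
  withColours = concatMap (λ u → (u , false) ∷ (u , true) ∷ [])

  insertTop : ∀ {n} → Vec (Letter n) n × Bool → List (Vec (Letter (suc n)) (suc n))
  insertTop (u , c) = insertsᵛ (top , c) (liftWord u)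

  signedPerms : (n : ℕ) → List (Vec (Letter n) n)
  signedPerms zero = [] ∷ []
  signedPerms (suc n) = concatMap insertTop (withColours (signedPerms n))

  IsPerm : ∀ {n} → Vec (Letter n) n → Set
  IsPerm {n} u = (i : Fin n) → i Vec∈.∈ Vec.map proj₁ u

  ∈-withColours⁺ : ∀ {X : Set} {u : X} c xs → u ∈ xs → (u , c) ∈ withColours xs
  ∈-withColours⁺ false xs u∈ = ∈-concatMap-intro _ u∈ (here refl)
  ∈-withColours⁺ true xs u∈ = ∈-concatMap-intro _ u∈ (there (here refl))

  ∈-withColours⁻ : ∀ {X : Set} {p : X × Bool} xs → p ∈ withColours xs → proj₁ p ∈ xs
  ∈-withColours⁻ xs p∈ with ∈-concatMap-elim _ xs p∈
  ... | a , a∈ , here refl = a∈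
  ... | a , a∈ , there (here refl) = a∈

  withColours-unique : ∀ {X : Set} (xs : List X) → Unique xs → Unique (withColours xs)
  withColours-unique xs xs! = concatMap-unique _ proj₁ xs xs! (λ a _ → ((λ ()) All.∷ All.[]) AllPairs.∷ All.[] AllPairs.∷ AllPairs.[])
    (λ { a b a∈ (here refl) → refl ; a b a∈ (there (here refl)) → refl })

  signedPerms-unique : ∀ n → Unique (signedPerms n)
  signedPerms-unique zero = All.[] AllPairs.∷ AllPairs.[]
  signedPerms-unique (suc n) =
    concatMap-unique insertTop (λ u → lowerWord (removeTop u) , colourOfTop u) (withColours (signedPerms n))
      (withColours-unique _ (signedPerms-unique n))
      (λ { (u , c) _ → insertsᵛ-unique (liftWord u) (λ top∈ → liftWord-no-top u _ top∈ refl) })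
      (λ { (u , c) b _ b∈ → let removed , coloured = removeTop-insertsᵛ c u b∈
                            in cong₂ _,_ (trans (cong lowerWord removed) (lowerWord-liftWord u)) coloured })

  unlift : ∀ {n} (i : Fin (suc n)) → i ≢ top → Σ (Fin n) λ j → inject₁ j ≡ i
  unlift {zero} zero i≢top = ⊥-elim (i≢top refl)
  unlift {suc n} zero _ = zero , refl
  unlift {suc n} (suc i) i≢top with unlift i (i≢top ∘ cong suc)
  ... | j , e = suc j , cong suc e

  signedPerms-sound : ∀ n u → u ∈ signedPerms n → IsPerm u
  signedPerms-sound zero [] _ ()
  signedPerms-sound (suc n) u u∈ i with ∈-concatMap-elim insertTop (withColours (signedPerms n)) u∈
  ... | (u₀ , c) , p∈ , u∈block with i Fin.≟ top
  ... | yes refl = Vec∈ₚ.∈-map⁺ proj₁ (∈-insertsᵛ-new (liftWord u₀) u∈block)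
  ... | no i≢top with unlift i i≢top
  ... | j , refl with vec-∈-map⁻ proj₁ u₀ (signedPerms-sound n u₀ (∈-withColours⁻ (signedPerms n) p∈) j)
  ... | y₀ , y₀∈ , refl = Vec∈ₚ.∈-map⁺ proj₁ (∈-insertsᵛ-old (liftWord u₀) u∈block (Vec∈ₚ.∈-map⁺ liftLetter y₀∈))

  split : ∀ {N m} (u : Vec (Letter N) (suc m)) (t : Fin N) → t Vec∈.∈ Vec.map proj₁ u →
          Σ Bool λ c → Σ (Vec (Letter N) m) λ u′ → u ∈ insertsᵛ (t , c) u′
  split ((a , c) ∷ []) t (VecAny.here refl) = c , [] , here refl
  split ((a , c) ∷ ys@(_ ∷ _)) t (VecAny.here refl) = c , ys , here refl
  split (y ∷ ys@(_ ∷ _)) t (VecAny.there p) with split ys t p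
  ... | c , u′ , q = c , y ∷ u′ , there (∈-map⁺ (y ∷_) q)

  signedPerms-complete : ∀ n u → IsPerm u → u ∈ signedPerms n
  signedPerms-complete zero [] _ = here refl
  signedPerms-complete (suc n) u perm with split u top (perm top)
  ... | c , u′ , u∈ = ∈-concatMap-intro insertTop (∈-withColours⁺ c (signedPerms n) IH)
                                        (subst (λ v → u ∈ insertsᵛ (top , c) v) (sym lifted) u∈)
    where
    no-top : ∀ y → y Vec∈.∈ u′ → proj₁ y ≢ top
    no-top y y∈ y≡top = ℕₚ.<-irrefl refl (surjective⇒≤ (Vec.map proj₁ u′) cover)
      where
      cover : ∀ i → i Vec∈.∈ Vec.map proj₁ u′
      cover i with vec-∈-map⁻ proj₁ u (perm i)
      ... | y′ , y′∈ , refl with ∈-insertsᵛ⁻ u′ u∈ y′∈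
      ... | inj₁ refl = subst (Vec∈._∈ Vec.map proj₁ u′) y≡top (Vec∈ₚ.∈-map⁺ proj₁ y∈)
      ... | inj₂ y′∈u′ = Vec∈ₚ.∈-map⁺ proj₁ y′∈u′
    lifted : liftWord (lowerWord u′) ≡ u′
    lifted = liftWord-lowerWord u′ no-top
    lowered-perm : IsPerm (lowerWord u′)
    lowered-perm j with vec-∈-map⁻ proj₁ u (perm (inject₁ j))
    ... | y′ , y′∈ , y′≡ with ∈-insertsᵛ⁻ u′ u∈ y′∈
    ... | inj₁ refl = ⊥-elim (Finₚ.fromℕ≢inject₁ (sym y′≡))
    ... | inj₂ y′∈u′ with vec-∈-map⁻ liftLetter (lowerWord u′) (subst (y′ Vec∈.∈_) (sym lifted) y′∈u′)
    ... | y₀ , y₀∈ , refl = subst (Vec∈._∈ Vec.map proj₁ (lowerWord u′)) (sym (Finₚ.inject₁-injective y′≡))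
                                  (Vec∈ₚ.∈-map⁺ proj₁ y₀∈)
    IH = signedPerms-complete n (lowerWord u′) lowered-perm

  toSignedWord : ∀ {n} → Vec (Letter n) n → SignedWord n
  toSignedWord u = Vec.map proj₁ u , Vec.map proj₂ u

  zip-unzip : ∀ {A B : Set} {m} (u : Vec (A × B) m) → Vec.zip (Vec.map proj₁ u) (Vec.map proj₂ u) ≡ u
  zip-unzip [] = refl
  zip-unzip (x ∷ u) = cong (x ∷_) (zip-unzip u)

  letters-toSignedWord : ∀ {n} (u : Vec (Letter n) n) → letters (toSignedWord u) ≡ toList u
  letters-toSignedWord u = cong toList (zip-unzip u)

  signedWords : ∀ n → List (SignedWord n)
  signedWords n = List.map toSignedWord (signedPerms n)

  signedWords-enumerates : ∀ n → Enumerates (signedWords n)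
  signedWords-enumerates n = Uniqueₚ.map⁺ injective (signedPerms-unique n) , complete , sound
    where
    injective : ∀ {u u′} → toSignedWord u ≡ toSignedWord u′ → u ≡ u′
    injective {u} {u′} e = trans (sym (zip-unzip u)) (trans (cong (λ w → Vec.zip (proj₁ w) (proj₂ w)) e) (zip-unzip u′))
    complete : (w : SignedWord n) → IsSignedPerm w → w ∈ signedWords n
    complete (a , b) p = subst (_∈ signedWords n) (cong₂ _,_ (Vecₚ.map-proj₁-zip a b) (Vecₚ.map-proj₂-zip a b))
      (∈-map⁺ toSignedWord (signedPerms-complete n (Vec.zip a b) (λ i → subst (i Vec∈.∈_) (sym (Vecₚ.map-proj₁-zip a b)) (p i))))
    sound : (w : SignedWord n) → w ∈ signedWords n → IsSignedPerm w
    sound w w∈ with ∈-map⁻ toSignedWord w∈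
    ... | u , u∈ , refl = signedPerms-sound n u u∈

module ColourOrder where
  open import Data.Fin as Fin using (Fin; fromℕ; inject₁; toℕ; _<?_)
  import Data.Fin.Properties as Finₚ
  open import Data.Vec using ([]; _∷_)
  open import Data.List.Relation.Unary.All as All using (All; []; _∷_)
  import Data.List.Relation.Unary.All.Properties as Allₚ
  open import Relation.Nullary using (¬_; yes; no; Dec)
  open import Relation.Nullary.Decidable using (⌊_⌋; does; isYes≗does; dec-true; dec-false; does-≡; does-⇔)
  open import Function using (_⇔_; mk⇔)
  open ≡ using (refl; cong; cong₂; sym; trans; subst)
  open Enumeration using (liftLetter)
  open import Algebra.Properties.CommutativeSemigroup ℕₚ.+-commutativeSemigroup using (x∙yz≈y∙xz)

  module KeyOrder {A : Set} (key : A → ℕ) where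
    _≺_ : A → A → Bool
    x ≺ y = does (key x ℕ.<? key y)

    private
      does⇒ : ∀ {P : Set} (p? : Dec P) → does p? ≡ true → P
      does⇒ (yes p) _ = p

      does≡false⇒ : ∀ {P : Set} (p? : Dec P) → does p? ≡ false → ¬ P
      does≡false⇒ (no ¬p) _ = ¬p

      ≺⇒< : ∀ {x y} → x ≺ y ≡ true → key x ℕ.< key y
      ≺⇒< {x} {y} = does⇒ (key x ℕ.<? key y)

    ≺-trans : ∀ {x y z} → x ≺ y ≡ true → y ≺ z ≡ true → x ≺ z ≡ true
    ≺-trans {x} {y} {z} x≺y y≺z = dec-true (key x ℕ.<? key z) (ℕₚ.<-trans (≺⇒< x≺y) (≺⇒< y≺z))

    ≺-irrefl : ∀ x → x ≺ x ≡ false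
    ≺-irrefl x = dec-false (key x ℕ.<? key x) (ℕₚ.<-irrefl refl)

    ≺-total : ∀ {y z} → key y ≢ key z → y ≺ z ≡ false → z ≺ y ≡ true
    ≺-total {y} {z} y≢z y⊀z =
      dec-true (key z ℕ.<? key y) (ℕₚ.≤∧≢⇒< (ℕₚ.≮⇒≥ (does≡false⇒ (key y ℕ.<? key z) y⊀z)) (y≢z ∘ sym))

  -- Letters of a word together with a virtual letter in position 0.
  data Ext (n : ℕ) : Set where
    virtual : Ext n
    letter : Letter n → Ext n

  colourKey : ∀ {n} → Letter n → ℕ
  colourKey {n} (a , true) = toℕ a
  colourKey {n} (a , false) = suc (n ℕ.+ toℕ a)

  isYes-⇔ : ∀ {A B : Set} → A ⇔ B → (a? : Dec A) (b? : Dec B) → ⌊ a? ⌋ ≡ ⌊ b? ⌋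
  isYes-⇔ A⇔B a? b? = trans (isYes≗does a?) (trans (does-⇔ A⇔B a? b?) (sym (isYes≗does b?)))

  colourKey-<c : ∀ {n} (x y : Letter n) → does (colourKey x ℕ.<? colourKey y) ≡ x <c y
  colourKey-<c (a , true) (b , true) = trans (does-≡ (toℕ a ℕ.<? toℕ b) (a <? b)) (sym (isYes≗does (a <? b)))
  colourKey-<c {n} (a , true) (b , false) =
    dec-true (toℕ a ℕ.<? suc (n ℕ.+ toℕ b)) (ℕ.s≤s (ℕₚ.≤-trans (ℕₚ.<⇒≤ (Finₚ.toℕ<n a)) (ℕₚ.m≤m+n n (toℕ b))))
  colourKey-<c {n} (a , false) (b , true) =
    dec-false (suc (n ℕ.+ toℕ a) ℕ.<? toℕ b)
              (λ h → ℕₚ.<-irrefl refl (ℕₚ.<-trans (Finₚ.toℕ<n b) (ℕₚ.≤-trans (ℕ.s≤s (ℕₚ.m≤m+n n (toℕ a))) (ℕₚ.<⇒≤ h))))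
  colourKey-<c {n} (a , false) (b , false) =
    trans (does-⇔ (mk⇔ (λ h → ℕₚ.+-cancelˡ-< n _ _ (ℕₚ.≤-pred h)) (λ h → ℕ.s≤s (ℕₚ.+-monoʳ-< n h)))
                  (suc (n ℕ.+ toℕ a) ℕ.<? suc (n ℕ.+ toℕ b)) (a <? b))
          (sym (isYes≗does (a <? b)))

  -- Des: the virtual letter lies between the negative and the positive letters.
  desKey : ∀ {n} → Ext n → ℕ
  desKey {n} virtual = n
  desKey (letter x) = colourKey x

  -- Des*: the virtual letter is the least one.
  desStarKey : ∀ {n} → Ext n → ℕ
  desStarKey virtual = 0
  desStarKey (letter x) = suc (colourKey x)

  module DesOrder {n} = KeyOrder (desKey {n})
  module DesStarOrder {n} = KeyOrder (desStarKey {n})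

  desPosFrom≡descentsFrom : ∀ {n} (_≺_ : Ext n → Ext n → Bool) → (∀ x y → letter x ≺ letter y ≡ x <c y) →
    ∀ i (l : List (Letter n)) → desPosFrom i l ≡ Descents.descentsFrom _≺_ i (List.map letter l)
  desPosFrom≡descentsFrom _≺_ agree i [] = refl
  desPosFrom≡descentsFrom _≺_ agree i (x ∷ []) = refl
  desPosFrom≡descentsFrom _≺_ agree i (x ∷ y ∷ r) =
    cong₂ _++_ (cong (λ b → if b then i ∷ [] else []) (sym (agree y x))) (desPosFrom≡descentsFrom _≺_ agree (suc i) (y ∷ r))

  DesL : ∀ {n} → List (Letter n) → List ℕ
  DesL l = (if firstNeg l then 0 ∷ [] else []) ++ desPosFrom 1 l

  DesL≡descentsFrom : ∀ {n} (l : List (Letter n)) → DesL l ≡ Descents.descentsFrom DesOrder._≺_ 0 (virtual ∷ List.map letter l)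
  DesL≡descentsFrom [] = refl
  DesL≡descentsFrom {n} (x ∷ r) =
    cong₂ _++_ (cong (λ b → if b then 0 ∷ [] else []) (sym (letter-≺-virtual x)))
               (desPosFrom≡descentsFrom DesOrder._≺_ colourKey-<c 1 (x ∷ r))
    where
    letter-≺-virtual : (x : Letter n) → DesOrder._≺_ (letter x) virtual ≡ proj₂ x
    letter-≺-virtual (a , true) = dec-true (toℕ a ℕ.<? n) (Finₚ.toℕ<n a)
    letter-≺-virtual (a , false) = dec-false (suc (n ℕ.+ toℕ a) ℕ.<? n)
                                             (λ h → ℕₚ.<-irrefl refl (ℕₚ.<-trans h (ℕ.s≤s (ℕₚ.m≤m+n n (toℕ a)))))

  DesStarL≡descentsFrom : ∀ {n} (l : List (Letter n)) → desPosFrom 1 l ≡ Descents.descentsFrom DesStarOrder._≺_ 0 (virtual ∷ List.map letter l)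
  DesStarL≡descentsFrom [] = refl
  DesStarL≡descentsFrom (x ∷ r) =
    desPosFrom≡descentsFrom DesStarOrder._≺_ shifted-<c 1 (x ∷ r)
    where
    shifted-<c : ∀ x y → DesStarOrder._≺_ (letter x) (letter y) ≡ x <c y
    shifted-<c x y = trans (does-⇔ (mk⇔ ℕₚ.≤-pred ℕ.s≤s) (suc (colourKey x) ℕ.<? suc (colourKey y)) (colourKey x ℕ.<? colourKey y))
                           (colourKey-<c x y)

  sum-DesL : ∀ {n} (l : List (Letter n)) → sumℕ (DesL l) ≡ sumℕ (desPosFrom 1 l)
  sum-DesL [] = refl
  sum-DesL ((a , true) ∷ r) = refl
  sum-DesL ((a , false) ∷ r) = refl

  inject₁-<-⇔ : ∀ {n} (a b : Fin n) → (inject₁ a Fin.< inject₁ b) ⇔ (a Fin.< b)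
  inject₁-<-⇔ a b = mk⇔ (≡.subst₂ ℕ._<_ (Finₚ.toℕ-inject₁ a) (Finₚ.toℕ-inject₁ b))
                        (≡.subst₂ ℕ._<_ (sym (Finₚ.toℕ-inject₁ a)) (sym (Finₚ.toℕ-inject₁ b)))

  <c-liftLetter : ∀ {n} (x y : Letter n) → liftLetter x <c liftLetter y ≡ x <c y
  <c-liftLetter (a , true) (b , true) = isYes-⇔ (inject₁-<-⇔ a b) (inject₁ a <? inject₁ b) (a <? b)
  <c-liftLetter (a , true) (b , false) = refl
  <c-liftLetter (a , false) (b , true) = refl
  <c-liftLetter (a , false) (b , false) = isYes-⇔ (inject₁-<-⇔ a b) (inject₁ a <? inject₁ b) (a <? b)

  desPosFrom-lift : ∀ {n} i (l : List (Letter n)) → desPosFrom i (List.map liftLetter l) ≡ desPosFrom i l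
  desPosFrom-lift i [] = refl
  desPosFrom-lift i (x ∷ []) = refl
  desPosFrom-lift i (x ∷ y ∷ r) =
    cong₂ _++_ (cong (λ b → if b then i ∷ [] else []) (<c-liftLetter y x)) (desPosFrom-lift (suc i) (y ∷ r))

  DesL-lift : ∀ {n} (l : List (Letter n)) → DesL (List.map liftLetter l) ≡ DesL l
  DesL-lift [] = refl
  DesL-lift (x ∷ r) = cong ((if proj₂ x then 0 ∷ [] else []) ++_) (desPosFrom-lift 1 (x ∷ r))

  negL : ∀ {n} → List (Letter n) → ℕ
  negL l = sumℕ (List.map (bit ∘ proj₂) l)

  negL-lift : ∀ {n} (l : List (Letter n)) → negL (List.map liftLetter l) ≡ negL l
  negL-lift [] = refl
  negL-lift (x ∷ l) = cong (bit (proj₂ x) ℕ.+_) (negL-lift l)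

  negL-inserts : ∀ {n} (z : Letter n) (l : List (Letter n)) → All (λ l′ → negL l′ ≡ bit (proj₂ z) ℕ.+ negL l) (inserts z l)
  negL-inserts z [] = refl ∷ []
  negL-inserts z (y ∷ ys) =
    refl ∷ Allₚ.map⁺ (All.map (λ e → trans (cong (bit (proj₂ y) ℕ.+_) e) (x∙yz≈y∙xz (bit (proj₂ y)) (bit (proj₂ z)) (negL ys)))
                              (negL-inserts z ys))

  neg≡negL : ∀ {n} (u : Vec (Letter n) n) → neg (Enumeration.toSignedWord u) ≡ negL (toList u)
  neg≡negL u = go u
    where
    go : ∀ {n m} (u : Vec (Letter n) m) → countTrue (Vec.map proj₂ u) ≡ negL (toList u)
    go [] = refl
    go ((a , true) ∷ u) = cong suc (go u)
    go ((a , false) ∷ u) = go u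

  colourKey-lift≢top : ∀ {n} (y : Letter n) c → colourKey (liftLetter y) ≢ colourKey {suc n} (fromℕ n , c)
  colourKey-lift≢top {n} (a , true) true e =
    ℕₚ.<-irrefl (trans (sym (Finₚ.toℕ-inject₁ a)) (trans e (Finₚ.toℕ-fromℕ n))) (Finₚ.toℕ<n a)
  colourKey-lift≢top {n} (a , true) false e =
    ℕₚ.<-irrefl refl (ℕₚ.<-trans (subst (ℕ._< n) e (Finₚ.inject₁ℕ< a)) (ℕ.s≤s (ℕₚ.≤-trans (ℕₚ.n≤1+n n) (ℕₚ.m≤m+n (suc n) _))))
  colourKey-lift≢top {n} (a , false) true e =
    ℕₚ.<-irrefl refl (ℕₚ.≤-trans (subst (ℕ._< suc n) (sym e) (Finₚ.toℕ<n (fromℕ n))) (ℕ.s≤s (ℕₚ.≤-trans (ℕₚ.n≤1+n n) (ℕₚ.m≤m+n (suc n) _))))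
  colourKey-lift≢top {n} (a , false) false e =
    ℕₚ.<-irrefl (trans (sym (Finₚ.toℕ-inject₁ a)) (trans (ℕₚ.+-cancelˡ-≡ (suc n) _ _ (ℕₚ.suc-injective e)) (Finₚ.toℕ-fromℕ n))) (Finₚ.toℕ<n a)

  desKey-virtual≢top : ∀ {n} c → desKey {suc n} virtual ≢ desKey (letter (fromℕ n , c))
  desKey-virtual≢top {n} true e = ℕₚ.<-irrefl (sym (trans e (Finₚ.toℕ-fromℕ n))) (ℕₚ.n<1+n n)
  desKey-virtual≢top {n} false e = ℕₚ.<-irrefl (ℕₚ.suc-injective e) (ℕ.s≤s (ℕₚ.m≤m+n n (toℕ (fromℕ n))))

  desKey-virtual≺top : ∀ {n} c → DesOrder._≺_ {suc n} virtual (letter (fromℕ n , c)) ≡ not c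
  desKey-virtual≺top {n} true =
    dec-false (suc n ℕ.<? toℕ (fromℕ n))
              (λ h → ℕₚ.<-irrefl refl (ℕₚ.<-trans h (subst (ℕ._< suc n) (sym (Finₚ.toℕ-fromℕ n)) (ℕₚ.n<1+n n))))
  desKey-virtual≺top {n} false =
    dec-true (suc n ℕ.<? suc (suc n ℕ.+ toℕ (fromℕ n))) (ℕ.s≤s (ℕ.s≤s (ℕₚ.m≤m+n n _)))

module InsertionBlock {c ℓ} (R : CommutativeRing c ℓ)
  (key : ∀ {m} → ColourOrder.Ext m → ℕ)
  (DL : ∀ {m} → List (Letter m) → List ℕ)
  (DL≡descentsFrom : ∀ {m} (l : List (Letter m)) →
     DL l ≡ Descents.descentsFrom (ColourOrder.KeyOrder._≺_ key) 0 (ColourOrder.virtual ∷ List.map ColourOrder.letter l))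
  (DL-lift : ∀ {m} (l : List (Letter m)) → DL (List.map Enumeration.liftLetter l) ≡ DL l)
  (virtual≢top : ∀ {n} c → key {suc n} ColourOrder.virtual ≢ key (ColourOrder.letter (fromℕ n , c)))
  (lift≢top : ∀ {n} (y : Letter n) c → key (ColourOrder.letter (Enumeration.liftLetter y)) ≢ key (ColourOrder.letter (fromℕ n , c)))
  where
  open import Data.List.Relation.Unary.All as All using (All; []; _∷_)
  open CommutativeRing R
  open Alg R
  open AlgProperties R
  open ColourOrder using (virtual; letter; module KeyOrder; negL; negL-lift; negL-inserts)
  open Enumeration using (liftLetter)
  open import Relation.Binary.Reasoning.Setoid setoid

  module Order {n} = KeyOrder (key {n})
  module Insertionₙ (n : ℕ) = Insertion R (Order._≺_ {suc n}) (Order.≺-trans {suc n}) (Order.≺-irrefl {suc n})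

  virtualBit : ℕ → Bool → ℕ
  virtualBit n c = bit (Order._≺_ {suc n} virtual (letter (fromℕ n , c)))

  module _ (Q x t : Carrier) where
    descentWeight : ∀ {m} → List (Letter m) → Carrier
    descentWeight l = pow x (length (DL l)) * pow Q (sumℕ (DL l))

    signedWeight : ∀ {m} → List (Letter m) → Carrier
    signedWeight l = descentWeight l * pow t (negL l)

    descentWeight≈weight : ∀ {n} (l : List (Letter (suc n))) → descentWeight l ≈ Insertionₙ.weight n Q x (virtual ∷ List.map letter l)
    descentWeight≈weight l = reflexive (≡.cong₂ (λ a b → pow x (length a) * pow Q (sumℕ b)) (DL≡descentsFrom l) (DL≡descentsFrom l))

    top-comparable : ∀ {n} (l : List (Letter n)) c →
                     Insertionₙ.ComparableTo n (letter (fromℕ n , c)) (virtual ∷ List.map letter (List.map liftLetter l))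
    top-comparable l c = Order.≺-total (virtual≢top c) ∷ lifted l
      where
      lifted : ∀ l → All _ (List.map letter (List.map liftLetter l))
      lifted [] = []
      lifted (y ∷ l) = Order.≺-total (lift≢top y c) ∷ lifted l

    insertTop-sum : ∀ {n} c b → virtualBit n c ≡ b → (l : List (Letter n)) (s : ℕ) →
      suc (length l) ≡ b ℕ.+ length (DL l) ℕ.+ s →
      sumList signedWeight (inserts (fromℕ n , c) (List.map liftLetter l))
      ≈ (descentWeight l * (qint Q (b ℕ.+ length (DL l)) + x * pow Q (b ℕ.+ length (DL l)) * qint Q s)) * pow t (bit c ℕ.+ negL l)
    insertTop-sum {n} c .(virtualBit n c) ≡.refl l s hs = begin
      sumList signedWeight (inserts z l↑)
        ≈⟨ sumList-All-cong (All.map (λ e → *-congˡ (reflexive (≡.cong (pow t) e))) (negL-inserts z l↑)) ⟩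
      sumList (λ l′ → descentWeight l′ * pow t (bit c ℕ.+ negL l↑)) (inserts z l↑)
        ≈⟨ sumList-*ʳ descentWeight _ (inserts z l↑) ⟩
      sumList descentWeight (inserts z l↑) * pow t (bit c ℕ.+ negL l↑)
        ≈⟨ *-cong descent-part (reflexive (≡.cong (λ k → pow t (bit c ℕ.+ k)) (negL-lift l))) ⟩
      (descentWeight l * (qint Q (b ℕ.+ D) + x * pow Q (b ℕ.+ D) * qint Q s)) * pow t (bit c ℕ.+ negL l) ∎
      where
      open Insertionₙ n using (weight; ndes; insertion-sum)
      z = (fromℕ n , c)
      l↑ = List.map liftLetter l
      b = virtualBit n c
      D = length (DL l)
      D↑ = ndes (virtual ∷ List.map letter l↑)
      ndes≡D : D↑ ≡ D
      ndes≡D = ≡.trans (≡.cong length (≡.sym (DL≡descentsFrom l↑))) (≡.cong length (DL-lift l))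
      hs′ : suc (length (List.map letter l↑)) ≡ b ℕ.+ D↑ ℕ.+ s
      hs′ = ≡.trans (≡.cong suc (≡.trans (Listₚ.length-map letter l↑) (Listₚ.length-map liftLetter l)))
                    (≡.trans hs (≡.cong (λ k → b ℕ.+ k ℕ.+ s) (≡.sym ndes≡D)))
      descent-part : sumList descentWeight (inserts z l↑) ≈ descentWeight l * (qint Q (b ℕ.+ D) + x * pow Q (b ℕ.+ D) * qint Q s)
      descent-part = begin
        sumList descentWeight (inserts z l↑)
          ≈⟨ sumList-cong (inserts z l↑) descentWeight≈weight ⟩
        sumList (λ l′ → weight Q x (virtual ∷ List.map letter l′)) (inserts z l↑)
          ≈⟨ sumList-map (λ l′ → weight Q x (virtual ∷ l′)) (List.map letter) (inserts z l↑) ⟨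
        sumList (λ l′ → weight Q x (virtual ∷ l′)) (List.map (List.map letter) (inserts z l↑))
          ≡⟨ ≡.cong (sumList (λ l′ → weight Q x (virtual ∷ l′))) (map-inserts letter z l↑) ⟩
        sumList (λ l′ → weight Q x (virtual ∷ l′)) (inserts (letter z) (List.map letter l↑))
          ≈⟨ sumList-map (weight Q x) (virtual ∷_) (inserts (letter z) (List.map letter l↑)) ⟨
        sumList (weight Q x) (List.map (virtual ∷_) (inserts (letter z) (List.map letter l↑)))
          ≈⟨ insertion-sum (letter z) Q x virtual (List.map letter l↑) s (top-comparable l c) hs′ ⟩
        weight Q x (virtual ∷ List.map letter l↑) * (qint Q (b ℕ.+ D↑) + x * pow Q (b ℕ.+ D↑) * qint Q s)
          ≈⟨ *-cong (sym (descentWeight≈weight l↑)) (reflexive (≡.cong (λ k → qint Q (b ℕ.+ k) + x * pow Q (b ℕ.+ k) * qint Q s) ndes≡D)) ⟩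
        descentWeight l↑ * (qint Q (b ℕ.+ D) + x * pow Q (b ℕ.+ D) * qint Q s)
          ≡⟨ ≡.cong (λ a → pow x (length a) * pow Q (sumℕ a) * (qint Q (b ℕ.+ D) + x * pow Q (b ℕ.+ D) * qint Q s)) (DL-lift l) ⟩
        descentWeight l * (qint Q (b ℕ.+ D) + x * pow Q (b ℕ.+ D) * qint Q s) ∎

  length-DL≤ : ∀ {m} (l : List (Letter m)) → length (DL l) ℕ.≤ length l
  length-DL≤ l = ≡.subst₂ ℕ._≤_ (≡.cong length (≡.sym (DL≡descentsFrom l))) (Listₚ.length-map letter l)
                          (Descents.length-descentsFrom≤ Order._≺_ 0 virtual (List.map letter l))

module SignedWordSums {c ℓ} (R : CommutativeRing c ℓ) where
  open import Data.Vec using ([]; _∷_)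
  open import Function using (mk⇔)
  open import Data.List.Membership.Propositional.Properties.WithK using (unique∧set⇒bag)
  open import Data.List.Relation.Binary.BagAndSetEquality using (∼bag⇒↭)
  open CommutativeRing R
  open Alg R
  open AlgProperties R
  open Enumeration using (signedWords; signedPerms; toSignedWord; insertsᵛ; liftWord; liftLetter; top; insertTop; withColours)
  open import Relation.Binary.Reasoning.Setoid setoid

  sumList-Enumerates : ∀ {n} {L L′ : List (SignedWord n)} → Enumerates L → Enumerates L′ →
                       (f : SignedWord n → Carrier) → sumList f L ≈ sumList f L′
  sumList-Enumerates (L! , L-complete , L-sound) (L′! , L′-complete , L′-sound) f =
    sumList-↭ f (∼bag⇒↭ (unique∧set⇒bag L! L′! (λ {w} → mk⇔ (λ w∈ → L′-complete w (L-sound w w∈))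
                                                            (λ w∈ → L-complete w (L′-sound w w∈)))))

  toList-insertsᵛ : ∀ {A : Set} {m} (z : A) (v : Vec A m) → List.map toList (insertsᵛ z v) ≡ inserts z (toList v)
  toList-insertsᵛ z [] = ≡.refl
  toList-insertsᵛ z (y ∷ ys) = ≡.cong ((z ∷ y ∷ toList ys) ∷_)
    (≡.trans (≡.sym (Listₚ.map-∘ (insertsᵛ z ys))) (≡.trans (Listₚ.map-∘ (insertsᵛ z ys)) (≡.cong (List.map (y ∷_)) (toList-insertsᵛ z ys))))

  toList-liftWord : ∀ {n m} (u : Vec (Letter n) m) → toList (liftWord u) ≡ List.map liftLetter (toList u)
  toList-liftWord [] = ≡.refl
  toList-liftWord (x ∷ u) = ≡.cong (_ ∷_) (toList-liftWord u)

  sumList-insertTop : ∀ {n} (g : Vec (Letter (suc n)) (suc n) → Carrier) (ω : List (Letter (suc n)) → Carrier) →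
    (∀ u → g u ≈ ω (toList u)) → ∀ (u₀ : Vec (Letter n) n) c →
    sumList g (insertTop (u₀ , c)) ≈ sumList ω (inserts (top , c) (List.map liftLetter (toList u₀)))
  sumList-insertTop g ω g≈ω u₀ c = begin
    sumList g (insertsᵛ (top , c) (liftWord u₀))
      ≈⟨ sumList-cong (insertsᵛ (top , c) (liftWord u₀)) g≈ω ⟩
    sumList (λ u → ω (toList u)) (insertsᵛ (top , c) (liftWord u₀))
      ≈⟨ sumList-map ω toList (insertsᵛ (top , c) (liftWord u₀)) ⟨
    sumList ω (List.map toList (insertsᵛ (top , c) (liftWord u₀)))
      ≡⟨ ≡.cong (sumList ω) (≡.trans (toList-insertsᵛ _ (liftWord u₀)) (≡.cong (inserts (top , c)) (toList-liftWord u₀))) ⟩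
    sumList ω (inserts (top , c) (List.map liftLetter (toList u₀))) ∎

  sumList-signedWords-suc : ∀ {n} (g : SignedWord (suc n) → Carrier) →
    sumList g (signedWords (suc n))
    ≈ sumList (λ u₀ → sumList (g ∘ toSignedWord) (insertTop (u₀ , false)) + (sumList (g ∘ toSignedWord) (insertTop (u₀ , true)) + 0#))
              (signedPerms n)
  sumList-signedWords-suc {n} g = begin
    sumList g (List.map toSignedWord (signedPerms (suc n)))
      ≈⟨ sumList-map g toSignedWord (signedPerms (suc n)) ⟩
    sumList (g ∘ toSignedWord) (List.concatMap insertTop (withColours (signedPerms n)))
      ≈⟨ sumList-concatMap (g ∘ toSignedWord) insertTop (withColours (signedPerms n)) ⟩
    sumList (λ p → sumList (g ∘ toSignedWord) (insertTop p)) (withColours (signedPerms n))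
      ≈⟨ sumList-concatMap (λ p → sumList (g ∘ toSignedWord) (insertTop p)) _ (signedPerms n) ⟩
    _ ∎

module DesBlock {c ℓ} (R : CommutativeRing c ℓ) =
  InsertionBlock R ColourOrder.desKey ColourOrder.DesL ColourOrder.DesL≡descentsFrom ColourOrder.DesL-lift
                 ColourOrder.desKey-virtual≢top ColourOrder.colourKey-lift≢top

module DesStarBlock {c ℓ} (R : CommutativeRing c ℓ) =
  InsertionBlock R ColourOrder.desStarKey (desPosFrom 1) ColourOrder.DesStarL≡descentsFrom (ColourOrder.desPosFrom-lift 1)
                 (λ _ ()) (λ y c → ColourOrder.colourKey-lift≢top y c ∘ ℕₚ.suc-injective)

module DescentSplit {c ℓ} (R : CommutativeRing c ℓ) (Q : CommutativeRing.Carrier R) where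
  open CommutativeRing R
  open Alg R
  open AlgProperties R

  qint-suc-split : ∀ {n d s} → n ≡ d ℕ.+ s → qint Q (suc n) ≈ qint Q d + pow Q d * (1# + Q * qint Q s)
  qint-suc-split {n} {d} {s} n≡d+s = begin
    qint Q (suc n)                              ≡⟨ ≡.cong (qint Q) (≡.trans (≡.cong suc n≡d+s) (≡.sym (ℕₚ.+-suc d s))) ⟩
    qint Q (d ℕ.+ suc s)                        ≈⟨ qint-+ Q d (suc s) ⟩
    qint Q d + pow Q d * qint Q (suc s)         ≈⟨ +-congˡ (*-congˡ (qint-suc Q s)) ⟩
    qint Q d + pow Q d * (1# + Q * qint Q s)    ∎
    where open import Relation.Binary.Reasoning.Setoid setoid

  n≡d+[n∸d] : ∀ {m} (DL : List (Letter m) → List ℕ) → (∀ l → length (DL l) ℕ.≤ length l) →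
              ∀ {n} (u : Vec (Letter m) n) → n ≡ length (DL (toList u)) ℕ.+ (n ∸ length (DL (toList u)))
  n≡d+[n∸d] DL bound {n} u = ≡.sym (ℕₚ.m+[n∸m]≡n (≡.subst (length (DL (toList u)) ℕ.≤_) (Vecₚ.length-toList u) (bound (toList u))))

module FmajSum {c ℓ} (R : CommutativeRing c ℓ) (q : CommutativeRing.Carrier R) (k l : ℕ) where
  open CommutativeRing R
  open Alg R
  open AlgProperties R
  open IntegerSolver R using (solve; _:=_; _:+_; _:*_; con)
  open Enumeration using (signedWords; signedPerms; toSignedWord; insertTop; letters-toSignedWord)
  open ColourOrder using (DesL; negL; neg≡negL; desKey-virtual≺top)
  open SignedWordSums R
  open DescentSplit R (pow q k)
  open DesBlock R using (insertTop-sum; signedWeight; descentWeight; length-DL≤)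
  open import Relation.Binary.Reasoning.Setoid setoid

  Q t : Carrier
  Q = pow q k
  t = pow q l

  fmaj-weight : ∀ {n} (w : SignedWord n) → pow q (fmaj k l w) ≈ pow Q (maj w) * pow t (neg w)
  fmaj-weight w = trans (pow-+ q (k ℕ.* maj w) (l ℕ.* neg w)) (*-cong (pow-pow q k (maj w)) (pow-pow q l (neg w)))

  fmaj-weight-[] : pow q (fmaj k l (toSignedWord {0} Vec.[])) ≈ 1#
  fmaj-weight-[] = trans (fmaj-weight (toSignedWord {0} Vec.[])) (*-identityˡ _)

  fmaj-weight≈signedWeight : ∀ {m} (u : Vec (Letter m) m) → pow q (fmaj k l (toSignedWord u)) ≈ signedWeight Q 1# t (toList u)
  fmaj-weight≈signedWeight u = begin
    pow q (fmaj k l w)                                   ≈⟨ fmaj-weight w ⟩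
    pow Q (maj w) * pow t (neg w)                        ≈⟨ *-congʳ (sym (trans (*-congʳ (pow-1# (des w))) (*-identityˡ _))) ⟩
    (pow 1# (des w) * pow Q (maj w)) * pow t (neg w)     ≡⟨ ≡.cong₂ (λ l′ m → (pow 1# (length (DesL l′)) * pow Q (sumℕ (DesL l′))) * pow t m)
                                                                  (letters-toSignedWord u) (neg≡negL u) ⟩
    signedWeight Q 1# t (toList u)                       ∎
    where w = toSignedWord u

  private
    insertion-identity : ∀ W D QD s T →
      (W * ((D + QD) + 1# * (Q * QD) * s)) * T + ((W * (D + 1# * QD * (1# + Q * s))) * (t * T) + 0#)
      ≈ ((1# + t) * (D + QD * (1# + Q * s))) * (W * T)
    insertion-identity W D QD s T =
      solve 7 (λ W D P Q s t T →
                 (W :* ((D :+ P) :+ con (1 , 0) :* (Q :* P) :* s)) :* T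
                   :+ ((W :* (D :+ con (1 , 0) :* P :* (con (1 , 0) :+ Q :* s))) :* (t :* T) :+ con (0 , 0))
                 := ((con (1 , 0) :+ t) :* (D :+ P :* (con (1 , 0) :+ Q :* s))) :* (W :* T))
              refl W D QD Q s t T

  insertTop-fmajSum : ∀ {n} (u₀ : Vec (Letter n) n) →
    sumList (λ u → pow q (fmaj k l (toSignedWord u))) (insertTop (u₀ , false))
      + (sumList (λ u → pow q (fmaj k l (toSignedWord u))) (insertTop (u₀ , true)) + 0#)
    ≈ ((1# + t) * qint Q (suc n)) * pow q (fmaj k l (toSignedWord u₀))
  insertTop-fmajSum {n} u₀ = begin
    _ ≈⟨ +-cong (trans (sumList-insertTop _ (signedWeight Q 1# t) fmaj-weight≈signedWeight u₀ false)
                       (insertTop-sum Q 1# t {n} false 1 (≡.cong bit (desKey-virtual≺top {n} false)) l₀ s (≡.cong suc len≡D+s)))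
                (+-congʳ (trans (sumList-insertTop _ (signedWeight Q 1# t) fmaj-weight≈signedWeight u₀ true)
                                (insertTop-sum Q 1# t {n} true 0 (≡.cong bit (desKey-virtual≺top {n} true)) l₀ (suc s)
                                               (≡.trans (≡.cong suc len≡D+s) (≡.sym (ℕₚ.+-suc D s)))))) ⟩
    (W * (qint Q (suc D) + 1# * pow Q (suc D) * qint Q s)) * pow t N
      + ((W * (qint Q D + 1# * pow Q D * qint Q (suc s))) * (t * pow t N) + 0#)
      ≈⟨ +-congˡ (+-congʳ (*-congʳ (*-congˡ (+-congˡ (*-congˡ (qint-suc Q s)))))) ⟩
    (W * ((qint Q D + pow Q D) + 1# * (Q * pow Q D) * qint Q s)) * pow t N
      + ((W * (qint Q D + 1# * pow Q D * (1# + Q * qint Q s))) * (t * pow t N) + 0#)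
      ≈⟨ insertion-identity W (qint Q D) (pow Q D) (qint Q s) (pow t N) ⟩
    ((1# + t) * (qint Q D + pow Q D * (1# + Q * qint Q s))) * (W * pow t N)
      ≈⟨ *-cong (*-congˡ (sym (qint-suc-split {n} {D} {s} n≡D+s))) (sym (fmaj-weight≈signedWeight u₀)) ⟩
    ((1# + t) * qint Q (suc n)) * pow q (fmaj k l (toSignedWord u₀)) ∎
    where
    l₀ = toList u₀
    D = length (DesL l₀)
    N = negL l₀
    s = n ∸ D
    W = descentWeight Q 1# t l₀
    n≡D+s : n ≡ D ℕ.+ s
    n≡D+s = n≡d+[n∸d] {n} DesL length-DL≤ u₀
    len≡D+s : length l₀ ≡ D ℕ.+ s
    len≡D+s = ≡.trans (Vecₚ.length-toList u₀) n≡D+s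

  fmajSum-signedWords : ∀ n → fmajSum k l q (signedWords n) ≈ pow (1# + t) n * qfact Q n
  fmajSum-signedWords zero = trans (+-identityʳ _) (trans fmaj-weight-[] (sym (*-identityˡ _)))
  fmajSum-signedWords (suc n) = begin
    sumList wt (signedWords (suc n))                                     ≈⟨ sumList-signedWords-suc {n} wt ⟩
    sumList _ (signedPerms n)                                            ≈⟨ sumList-cong (signedPerms n) insertTop-fmajSum ⟩
    sumList (λ u₀ → ((1# + t) * qint Q (suc n)) * wt (toSignedWord u₀)) (signedPerms n)
                                                                         ≈⟨ sumList-*ˡ (wt ∘ toSignedWord) _ (signedPerms n) ⟩
    ((1# + t) * qint Q (suc n)) * sumList (wt ∘ toSignedWord) (signedPerms n)
                                                                         ≈⟨ *-congˡ (sym (sumList-map wt toSignedWord (signedPerms n))) ⟩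
    ((1# + t) * qint Q (suc n)) * fmajSum k l q (signedWords n)          ≈⟨ *-congˡ (fmajSum-signedWords n) ⟩
    ((1# + t) * qint Q (suc n)) * (pow (1# + t) n * qfact Q n)           ≈⟨ solve 4 (λ a I A F → (a :* I) :* (A :* F) := (a :* A) :* (F :* I)) refl (1# + t) (qint Q (suc n)) (pow (1# + t) n) (qfact Q n) ⟩
    pow (1# + t) (suc n) * qfact Q (suc n)                               ∎
    where
    wt : ∀ {m} → SignedWord m → Carrier
    wt w = pow q (fmaj k l w)

module Monomials {c ℓ} (R : CommutativeRing c ℓ) (Q : CommutativeRing.Carrier R) where
  open CommutativeRing R
  open Alg R
  open PowerSeries R
  open QOperators R Q
  open import Relation.Binary.Reasoning.Setoid setoid
  private module 𝕊 = CommutativeRing seriesRing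

  monomial : ℕ → Carrier → Series
  monomial d a m = if d ℕ.≡ᵇ m then a else 0#

  Xᵈ : ℕ → Series
  Xᵈ = Alg.pow seriesRing X

  monomial≋Xᵈ⋆const : ∀ d a → monomial d a ≋ Xᵈ d ⋆ const a
  monomial≋Xᵈ⋆const zero a zero = sym (trans (⋆-identityˡ (const a) 0) (*-identityʳ a))
  monomial≋Xᵈ⋆const zero a (suc m) = sym (trans (⋆-identityˡ (const a) (suc m)) (zeroʳ a))
  monomial≋Xᵈ⋆const (suc d) a zero = sym (trans (⋆-assoc X (Xᵈ d) (const a) 0) (X-⋆-at-0 (Xᵈ d ⋆ const a)))
  monomial≋Xᵈ⋆const (suc d) a (suc m) =
    sym (trans (⋆-assoc X (Xᵈ d) (const a) (suc m)) (trans (X-⋆-at-suc (Xᵈ d ⋆ const a) m) (sym (monomial≋Xᵈ⋆const d a m))))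

  private
    ≡ᵇ⇒≡ : ∀ d m → (d ℕ.≡ᵇ m) ≡ true → d ≡ m
    ≡ᵇ⇒≡ zero zero _ = ≡.refl
    ≡ᵇ⇒≡ (suc d) (suc m) e = ≡.cong suc (≡ᵇ⇒≡ d m e)

    diagonal-monomial : ∀ (h : ℕ → Carrier) d a → (λ m → h m * monomial d a m) ≋ const (h d) ⋆ monomial d a
    diagonal-monomial h d a m = trans diag (sym (const-⋆ (h d) (monomial d a) m))
      where
      diag : h m * monomial d a m ≈ h d * monomial d a m
      diag with d ℕ.≡ᵇ m in d≡m
      ... | true = *-congʳ (reflexive (≡.cong h (≡.sym (≡ᵇ⇒≡ d m d≡m))))
      ... | false = trans (zeroʳ _) (sym (zeroʳ _))

  ∂-monomial : ∀ d a → ∂ (monomial d a) ≋ const (qint Q d) ⋆ monomial d a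
  ∂-monomial = diagonal-monomial (qint Q)

  σ-monomial : ∀ d a → σ (monomial d a) ≋ const (pow Q d) ⋆ monomial d a
  σ-monomial = diagonal-monomial (pow Q)

  statSeries≋ : ∀ {n} (s : SignedWord n → ℕ) k l q L →
                statSeries s k l q L ≋ Alg.sumList seriesRing (λ w → monomial (s w) (pow q (fmaj k l w))) L
  statSeries≋ s k l q [] m = refl
  statSeries≋ s k l q (w ∷ L) m = +-congˡ (statSeries≋ s k l q L m)

  ⊝-⋆ : ∀ f g → (⊝ f) ⋆ g ≋ ⊝ (f ⋆ g)
  ⊝-⋆ f g m = trans (AlgProperties.sumBelow-cong R (suc m) (λ j → sym (-‿distribˡ-* (f j) (g (m ∸ j)))))
                    (AlgProperties.sumBelow-neg R (suc m) _)
    where open import Algebra.Properties.Ring ring using (-‿distribˡ-*)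

  constant-coefficients⋆poch₁ : ∀ G → (∀ j → G j ≈ 1#) → G ⋆ poch Q 1 ≋ oneS
  constant-coefficients⋆poch₁ G G≈1 = 𝕊.trans (⋆-congˡ G (⋆-identityˡ 1-X)) (𝕊.trans (⋆-comm G 1-X) telescope)
    where
    open import Algebra.Properties.Ring ring using (-0#≈0#)
    shift-1-X : shift 1-X ≋ ⊝ oneS
    shift-1-X zero = refl
    shift-1-X (suc j) = sym -0#≈0#
    telescope : 1-X ⋆ G ≋ oneS
    telescope zero = trans (⋆-at-0 1-X G) (trans (*-identityˡ _) (G≈1 0))
    telescope (suc m) = begin
      (1-X ⋆ G) (suc m)                        ≈⟨ ⋆-at-suc 1-X G m ⟩
      1# * G (suc m) + (shift 1-X ⋆ G) m       ≈⟨ +-cong (trans (*-identityˡ _) (G≈1 (suc m)))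
                                                         (trans (⋆-congʳ G shift-1-X m) (trans (⊝-⋆ oneS G m) (-‿cong (trans (⋆-identityˡ G m) (G≈1 m))))) ⟩
      1# + - 1#                                ≈⟨ -‿inverseʳ 1# ⟩
      0#                                       ∎

module AdditiveMaps {c ℓ} (R : CommutativeRing c ℓ) where
  open import Level using (_⊔_)
  open Alg R using (Series; _⋆_)
  open PowerSeries R
  open CommutativeRing seriesRing using (+-cong; +-congˡ; +-identityˡ; trans; refl)
  open IntegerSolver seriesRing using (solve; _:=_; _:+_; _:*_; con)

  record Additive (F : Series → Series) : Set (c ⊔ ℓ) where
    field
      preserves-≋ : ∀ {f g} → f ≋ g → F f ≋ F g
      preserves-0ₛ : F 0ₛ ≋ 0ₛ
      preserves-⊕ : ∀ f g → F (f ⊕ g) ≋ F f ⊕ F g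
  open Additive public

  sumList-Additive : ∀ {F} → Additive F → ∀ {A : Set} (h : A → Series) xs →
                     F (Alg.sumList seriesRing h xs) ≋ Alg.sumList seriesRing (λ x → F (h x)) xs
  sumList-Additive F+ h [] = preserves-0ₛ F+
  sumList-Additive F+ h (x ∷ xs) = trans (preserves-⊕ F+ (h x) _) (+-congˡ (sumList-Additive F+ h xs))

  ⋆-Additive : ∀ a → Additive (a ⋆_)
  ⋆-Additive a = record
    { preserves-≋ = ⋆-congˡ a
    ; preserves-0ₛ = solve 1 (λ a → a :* con (0 , 0) := con (0 , 0)) refl a
    ; preserves-⊕ = ⋆-distribˡ a }

  ∘-Additive : ∀ {F G} → Additive F → Additive G → Additive (λ f → F (G f))
  ∘-Additive F+ G+ = record
    { preserves-≋ = λ e → preserves-≋ F+ (preserves-≋ G+ e)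
    ; preserves-0ₛ = trans (preserves-≋ F+ (preserves-0ₛ G+)) (preserves-0ₛ F+)
    ; preserves-⊕ = λ f g → trans (preserves-≋ F+ (preserves-⊕ G+ f g)) (preserves-⊕ F+ _ _) }

  ⊕-Additive : ∀ {F G} → Additive F → Additive G → Additive (λ f → F f ⊕ G f)
  ⊕-Additive {F} {G} F+ G+ = record
    { preserves-≋ = λ e → +-cong (preserves-≋ F+ e) (preserves-≋ G+ e)
    ; preserves-0ₛ = trans (+-cong (preserves-0ₛ F+) (preserves-0ₛ G+)) (+-identityˡ 0ₛ)
    ; preserves-⊕ = λ f g → trans (+-cong (preserves-⊕ F+ f g) (preserves-⊕ G+ f g))
                                   (solve 4 (λ a b c d → (a :+ b) :+ (c :+ d) := (a :+ c) :+ (b :+ d)) refl (F f) (F g) (G f) (G g)) }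

module CoefficientSeries {c ℓ} (R : CommutativeRing c ℓ) (Q t : CommutativeRing.Carrier R) where
  open CommutativeRing R
  open Alg R
  open PowerSeries R
  open QOperators R Q
  open IntegerSolver R using (solve; _:=_; _:+_; _:*_; con)

  desCoefficients : ℕ → Series
  desCoefficients n j = pow (qint Q (suc j) + t * qint Q j) n

  desStarCoefficients : ℕ → Series
  desStarCoefficients n j = pow (1# + t) n * pow (qint Q (suc j)) n

  desCoefficients-suc : ∀ n → desCoefficients (suc n) ≋ const (1# + t) ⋆ ∂ (desCoefficients n) ⊕ σ (desCoefficients n)
  desCoefficients-suc n m =
    trans (solve 4 (λ I P t G → ((I :+ P) :+ t :* I) :* G := (con (1 , 0) :+ t) :* (I :* G) :+ P :* G) refl (qint Q m) (pow Q m) t (desCoefficients n m))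
          (+-congʳ (sym (const-⋆ (1# + t) (∂ (desCoefficients n)) m)))

  desStarCoefficients-suc : ∀ n → desStarCoefficients (suc n) ≋ const (1# + t) ⋆ (∂ (desStarCoefficients n) ⊕ σ (desStarCoefficients n))
  desStarCoefficients-suc n m =
    trans (solve 5 (λ t A I P B → ((con (1 , 0) :+ t) :* A) :* ((I :+ P) :* B) := (con (1 , 0) :+ t) :* (I :* (A :* B) :+ P :* (A :* B)))
                   refl t (pow (1# + t) n) (qint Q m) (pow Q m) (pow (qint Q (suc m)) n))
          (sym (const-⋆ (1# + t) (∂ (desStarCoefficients n) ⊕ σ (desStarCoefficients n)) m))

-- The polynomial identities behind one insertion step, with D = [d], P = Q^d,
-- K = Q, S = [s] for a word with d descents and n = d + s.
module InsertionIdentities {c ℓ} (S : CommutativeRing c ℓ) where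
  open CommutativeRing S
  open IntegerSolver S using (solve; _:=_; _:+_; _:*_; _:-_; con)

  des-identity : ∀ W T D P K s t X →
    (W * ((D + P) + X * (K * P) * s)) * T + ((W * (D + X * P * (1# + K * s))) * (t * T) + 0#)
    ≈ ((1# + t) * ((1# - X) * D + (D + P * (1# + K * s)) * X) + (1# - X) * P) * (W * T)
  des-identity = solve 8 (λ W T D P K s t X →
    (W :* ((D :+ P) :+ X :* (K :* P) :* s)) :* T :+ ((W :* (D :+ X :* P :* (con (1 , 0) :+ K :* s))) :* (t :* T) :+ con (0 , 0))
    := ((con (1 , 0) :+ t) :* ((con (1 , 0) :- X) :* D :+ (D :+ P :* (con (1 , 0) :+ K :* s)) :* X) :+ (con (1 , 0) :- X) :* P) :* (W :* T)) refl

  desStar-identity : ∀ W T D P K s t X →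
    (W * ((D + P) + X * (K * P) * s)) * T + ((W * ((D + P) + X * (K * P) * s)) * (t * T) + 0#)
    ≈ ((1# + t) * (((1# - X) * D + (D + P * (1# + K * s)) * X) + (1# - X) * P)) * (W * T)
  desStar-identity = solve 8 (λ W T D P K s t X →
    (W :* ((D :+ P) :+ X :* (K :* P) :* s)) :* T :+ ((W :* ((D :+ P) :+ X :* (K :* P) :* s)) :* (t :* T) :+ con (0 , 0))
    := ((con (1 , 0) :+ t) :* (((con (1 , 0) :- X) :* D :+ (D :+ P :* (con (1 , 0) :+ K :* s)) :* X) :+ (con (1 , 0) :- X) :* P)) :* (W :* T)) refl

module DescentSeries {c ℓ} (R : CommutativeRing c ℓ) (q : CommutativeRing.Carrier R) (k l : ℕ) where
  open CommutativeRing R using (1#; _+_; _*_)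
  open Alg R using (Series; _⋆_; oneS; poch; pow; qint)
  open PowerSeries R
  open QOperators R (pow q k)
  open Pochhammer R (pow q k) using (σ-⋆-poch; ∂-⋆-poch)
  open Monomials R (pow q k)
  open AdditiveMaps R
  open CoefficientSeries R (pow q k) (pow q l)
  open Enumeration using (signedWords; signedPerms; toSignedWord; insertTop; letters-toSignedWord)
  open ColourOrder using (DesL; negL; neg≡negL; desKey-virtual≺top; sum-DesL)
  open FmajSum R q k l using (Q; t; fmaj-weight; fmaj-weight-[])
  open SignedWordSums seriesRing using (sumList-insertTop; sumList-signedWords-suc)
  open InsertionIdentities seriesRing
  open DescentSplit seriesRing (const (pow q k))
  private
    module R = CommutativeRing R
    module 𝕊 = CommutativeRing seriesRing
    module 𝕊ᴬ = Alg seriesRing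
    module 𝕊ᶠ = AlgProperties seriesRing
    module Des = DesBlock seriesRing
    module DesStar = DesStarBlock seriesRing
  open 𝕊 using (refl; sym; trans; +-cong; +-congˡ; +-congʳ)
  open import Relation.Binary.Reasoning.Setoid 𝕊.setoid
  open IntegerSolver seriesRing using (solve; _:=_; _:+_; _:*_; con)

  KQ Kt : Series
  KQ = const Q
  Kt = const t

  monomial-fmaj : ∀ {m} d (u : Vec (Letter m) m) →
    monomial d (pow q (fmaj k l (toSignedWord u))) ≋ (Xᵈ d ⋆ 𝕊ᴬ.pow KQ (maj (toSignedWord u))) ⋆ 𝕊ᴬ.pow Kt (negL (toList u))
  monomial-fmaj d u = begin
    monomial d (pow q (fmaj k l w))                        ≈⟨ monomial≋Xᵈ⋆const d _ ⟩
    Xᵈ d ⋆ const (pow q (fmaj k l w))                      ≈⟨ ⋆-congˡ (Xᵈ d) (const-cong (fmaj-weight w)) ⟩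
    Xᵈ d ⋆ const (pow Q (maj w) * pow t (neg w))           ≈⟨ ⋆-congˡ (Xᵈ d) (𝕊.trans (const-* _ _) (⋆-cong (sym (const-pow Q (maj w))) (sym (const-pow t (neg w))))) ⟩
    Xᵈ d ⋆ (𝕊ᴬ.pow KQ (maj w) ⋆ 𝕊ᴬ.pow Kt (neg w))         ≈⟨ sym (⋆-assoc (Xᵈ d) (𝕊ᴬ.pow KQ (maj w)) (𝕊ᴬ.pow Kt (neg w))) ⟩
    (Xᵈ d ⋆ 𝕊ᴬ.pow KQ (maj w)) ⋆ 𝕊ᴬ.pow Kt (neg w)         ≡⟨ ≡.cong (λ m → (Xᵈ d ⋆ 𝕊ᴬ.pow KQ (maj w)) ⋆ 𝕊ᴬ.pow Kt m) (neg≡negL u) ⟩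
    (Xᵈ d ⋆ 𝕊ᴬ.pow KQ (maj w)) ⋆ 𝕊ᴬ.pow Kt (negL (toList u)) ∎
    where w = toSignedWord u

  desMonomial desStarMonomial : ∀ {m} → SignedWord m → Series
  desMonomial w = monomial (des w) (pow q (fmaj k l w))
  desStarMonomial w = monomial (desStar w) (pow q (fmaj k l w))

  desMonomial≋signedWeight : ∀ {m} (u : Vec (Letter m) m) → desMonomial (toSignedWord u) ≋ Des.signedWeight KQ X Kt (toList u)
  desMonomial≋signedWeight u = 𝕊.trans (monomial-fmaj (des (toSignedWord u)) u)
    (𝕊.reflexive (≡.cong (λ l′ → (Xᵈ (length (DesL l′)) ⋆ 𝕊ᴬ.pow KQ (sumℕ (DesL l′))) ⋆ 𝕊ᴬ.pow Kt (negL (toList u))) (letters-toSignedWord u)))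

  desStarMonomial≋signedWeight : ∀ {m} (u : Vec (Letter m) m) → desStarMonomial (toSignedWord u) ≋ DesStar.signedWeight KQ X Kt (toList u)
  desStarMonomial≋signedWeight u = 𝕊.trans (monomial-fmaj (desStar (toSignedWord u)) u)
    (𝕊.reflexive (≡.cong₂ (λ l′ m → (Xᵈ (length (desPosFrom 1 l′)) ⋆ 𝕊ᴬ.pow KQ m) ⋆ 𝕊ᴬ.pow Kt (negL (toList u)))
                          (letters-toSignedWord u)
                          (≡.trans (≡.cong (λ l′ → sumℕ (DesL l′)) (letters-toSignedWord u)) (sum-DesL (toList u)))))

  -- By ∂-⋆-poch and σ-⋆-poch, ∂ G ⋆ (x;Q)_{n+2} = Ψ n (G ⋆ (x;Q)_{n+1}) and
  -- σ G ⋆ (x;Q)_{n+2} = (1-x) σ (G ⋆ (x;Q)_{n+1}).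
  Ψ Φ Φ* : ℕ → Series → Series
  Ψ n P = 1-X ⋆ ∂ P ⊕ (const (qint Q (suc n)) ⋆ X) ⋆ P
  Φ n P = const (1# + t) ⋆ Ψ n P ⊕ 1-X ⋆ σ P
  Φ* n P = const (1# + t) ⋆ (Ψ n P ⊕ 1-X ⋆ σ P)

  ∂-Additive : Additive ∂
  σ-Additive : Additive σ
  ∂-Additive = record { preserves-≋ = ∂-cong ; preserves-0ₛ = ∂-0ₛ ; preserves-⊕ = ∂-⊕ }

  σ-Additive = record { preserves-≋ = σ-cong ; preserves-0ₛ = σ-0ₛ ; preserves-⊕ = σ-⊕ }

  Ψ-Additive : ∀ n → Additive (Ψ n)
  Ψ-Additive n = ⊕-Additive (∘-Additive (⋆-Additive 1-X) ∂-Additive) (⋆-Additive (const (qint Q (suc n)) ⋆ X))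

  Φ-Additive : ∀ n → Additive (Φ n)
  Φ-Additive n = ⊕-Additive (∘-Additive (⋆-Additive (const (1# + t))) (Ψ-Additive n)) (∘-Additive (⋆-Additive 1-X) σ-Additive)

  Φ*-Additive : ∀ n → Additive (Φ* n)
  Φ*-Additive n = ∘-Additive (⋆-Additive (const (1# + t))) (⊕-Additive (Ψ-Additive n) (∘-Additive (⋆-Additive 1-X) σ-Additive))

  multiplier multiplier* : ℕ → ℕ → Series
  multiplier n d = const (1# + t) ⋆ (1-X ⋆ const (qint Q d) ⊕ const (qint Q (suc n)) ⋆ X) ⊕ 1-X ⋆ const (pow Q d)
  multiplier* n d = const (1# + t) ⋆ ((1-X ⋆ const (qint Q d) ⊕ const (qint Q (suc n)) ⋆ X) ⊕ 1-X ⋆ const (pow Q d))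

  Φ-monomial : ∀ n d a → Φ n (monomial d a) ≋ multiplier n d ⋆ monomial d a
  Φ-monomial n d a = begin
    Φ n (monomial d a)
      ≈⟨ +-cong (⋆-congˡ A (+-congʳ {KN ⋆ x} (⋆-congˡ 1-X (∂-monomial d a)))) (⋆-congˡ 1-X (σ-monomial d a)) ⟩
    A ⋆ (1-X ⋆ (const (qint Q d) ⋆ x) ⊕ KN ⋆ x) ⊕ 1-X ⋆ (const (pow Q d) ⋆ x)
      ≈⟨ solve 6 (λ A O KD KN x KP → A :* (O :* (KD :* x) :+ KN :* x) :+ O :* (KP :* x) := (A :* (O :* KD :+ KN) :+ O :* KP) :* x)
               refl A 1-X (const (qint Q d)) KN x (const (pow Q d)) ⟩
    multiplier n d ⋆ x ∎
    where
    A = const (1# + t)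
    KN = const (qint Q (suc n)) ⋆ X
    x = monomial d a

  Φ*-monomial : ∀ n d a → Φ* n (monomial d a) ≋ multiplier* n d ⋆ monomial d a
  Φ*-monomial n d a = begin
    Φ* n (monomial d a)
      ≈⟨ ⋆-congˡ A (+-cong (+-congʳ {KN ⋆ x} (⋆-congˡ 1-X (∂-monomial d a))) (⋆-congˡ 1-X (σ-monomial d a))) ⟩
    A ⋆ ((1-X ⋆ (const (qint Q d) ⋆ x) ⊕ KN ⋆ x) ⊕ 1-X ⋆ (const (pow Q d) ⋆ x))
      ≈⟨ solve 6 (λ A O KD KN x KP → A :* ((O :* (KD :* x) :+ KN :* x) :+ O :* (KP :* x)) := (A :* ((O :* KD :+ KN) :+ O :* KP)) :* x)
               refl A 1-X (const (qint Q d)) KN x (const (pow Q d)) ⟩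
    multiplier* n d ⋆ x ∎
    where
    A = const (1# + t)
    KN = const (qint Q (suc n)) ⋆ X
    x = monomial d a

  private
    1+Kt 1-X′ : Series
    1+Kt = oneS ⊕ Kt
    1-X′ = oneS ⊕ ⊝ X

    parts≋ : ∀ {n d s} → n ≡ d ℕ.+ s →
      const (1# + t) ≋ 1+Kt × 1-X ≋ 1-X′ × const (qint Q d) ≋ 𝕊ᴬ.qint KQ d × const (pow Q d) ≋ 𝕊ᴬ.pow KQ d
      × const (qint Q (suc n)) ≋ 𝕊ᴬ.qint KQ d ⊕ 𝕊ᴬ.pow KQ d ⋆ (oneS ⊕ KQ ⋆ 𝕊ᴬ.qint KQ s)
    parts≋ {n} {d} {s} n≡d+s =
      trans (const-+ 1# t) (+-congʳ const-1#) , 1-X≋1⊕⊝X , sym (const-qint Q d) , sym (const-pow Q d) ,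
      trans (sym (const-qint Q (suc n))) (qint-suc-split {n} {d} {s} n≡d+s)

  multiplier≋ : ∀ {n d s} → n ≡ d ℕ.+ s → let D = 𝕊ᴬ.qint KQ d ; P = 𝕊ᴬ.pow KQ d ; S = 𝕊ᴬ.qint KQ s in
    multiplier n d ≋ 1+Kt ⋆ (1-X′ ⋆ D ⊕ (D ⊕ P ⋆ (oneS ⊕ KQ ⋆ S)) ⋆ X) ⊕ 1-X′ ⋆ P
  multiplier≋ {n} {d} {s} n≡d+s with A , O , D , P , N ← parts≋ {n} {d} {s} n≡d+s =
    +-cong (⋆-cong A (+-cong (⋆-cong O D) (⋆-congʳ X N))) (⋆-cong O P)

  multiplier*≋ : ∀ {n d s} → n ≡ d ℕ.+ s → let D = 𝕊ᴬ.qint KQ d ; P = 𝕊ᴬ.pow KQ d ; S = 𝕊ᴬ.qint KQ s in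
    multiplier* n d ≋ 1+Kt ⋆ ((1-X′ ⋆ D ⊕ (D ⊕ P ⋆ (oneS ⊕ KQ ⋆ S)) ⋆ X) ⊕ 1-X′ ⋆ P)
  multiplier*≋ {n} {d} {s} n≡d+s with A , O , D , P , N ← parts≋ {n} {d} {s} n≡d+s =
    ⋆-cong A (+-cong (+-cong (⋆-cong O D) (⋆-congʳ X N)) (⋆-cong O P))

  private
    insertTopPair : ∀ {n} → (SignedWord (suc n) → Series) → Vec (Letter n) n → Series
    insertTopPair g u₀ = 𝕊ᴬ.sumList (g ∘ toSignedWord) (insertTop (u₀ , false))
                           ⊕ (𝕊ᴬ.sumList (g ∘ toSignedWord) (insertTop (u₀ , true)) ⊕ 0ₛ)

  insertTop-desMonomials : ∀ {n} (u₀ : Vec (Letter n) n) → insertTopPair desMonomial u₀ ≋ Φ n (desMonomial (toSignedWord u₀))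
  insertTop-desMonomials {n} u₀ = begin
    insertTopPair desMonomial u₀
      ≈⟨ +-cong (trans (sumList-insertTop _ (Des.signedWeight KQ X Kt) desMonomial≋signedWeight u₀ false)
                       (Des.insertTop-sum KQ X Kt {n} false 1 (≡.cong bit (desKey-virtual≺top {n} false)) l₀ s (≡.cong suc len≡D+s)))
                (+-congʳ (trans (sumList-insertTop _ (Des.signedWeight KQ X Kt) desMonomial≋signedWeight u₀ true)
                                (Des.insertTop-sum KQ X Kt {n} true 0 (≡.cong bit (desKey-virtual≺top {n} true)) l₀ (suc s)
                                                   (≡.trans (≡.cong suc len≡D+s) (≡.sym (ℕₚ.+-suc D s)))))) ⟩
    (W ⋆ ((Dq ⊕ P) ⊕ (X ⋆ (KQ ⋆ P)) ⋆ S)) ⋆ T ⊕ ((W ⋆ (Dq ⊕ (X ⋆ P) ⋆ 𝕊ᴬ.qint KQ (suc s))) ⋆ (Kt ⋆ T) ⊕ 0ₛ)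
      ≈⟨ +-congˡ (+-congʳ {0ₛ} (⋆-congʳ (Kt ⋆ T) (⋆-congˡ W (+-congˡ {Dq} (⋆-congˡ (X ⋆ P) (𝕊ᶠ.qint-suc KQ s)))))) ⟩
    (W ⋆ ((Dq ⊕ P) ⊕ (X ⋆ (KQ ⋆ P)) ⋆ S)) ⋆ T ⊕ ((W ⋆ (Dq ⊕ (X ⋆ P) ⋆ (oneS ⊕ KQ ⋆ S))) ⋆ (Kt ⋆ T) ⊕ 0ₛ)
      ≈⟨ des-identity W T Dq P KQ S Kt X ⟩
    (1+Kt ⋆ (1-X′ ⋆ Dq ⊕ (Dq ⊕ P ⋆ (oneS ⊕ KQ ⋆ S)) ⋆ X) ⊕ 1-X′ ⋆ P) ⋆ (W ⋆ T)
      ≈⟨ ⋆-cong (sym (multiplier≋ {n} {D} {s} n≡D+s)) (sym (desMonomial≋signedWeight u₀)) ⟩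
    multiplier n D ⋆ desMonomial w₀
      ≡⟨ ≡.cong (λ d → multiplier n d ⋆ desMonomial w₀) (≡.cong (λ l′ → length (DesL l′)) (≡.sym (letters-toSignedWord u₀))) ⟩
    multiplier n (des w₀) ⋆ desMonomial w₀
      ≈⟨ sym (Φ-monomial n (des w₀) (pow q (fmaj k l w₀))) ⟩
    Φ n (desMonomial w₀) ∎
    where
    w₀ = toSignedWord u₀
    l₀ = toList u₀
    D = length (DesL l₀)
    s = n ∸ D
    Dq = 𝕊ᴬ.qint KQ D
    P = 𝕊ᴬ.pow KQ D
    S = 𝕊ᴬ.qint KQ s
    W = Des.descentWeight KQ X Kt l₀
    T = 𝕊ᴬ.pow Kt (negL l₀)
    n≡D+s : n ≡ D ℕ.+ s
    n≡D+s = n≡d+[n∸d] {n} DesL Des.length-DL≤ u₀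
    len≡D+s : length l₀ ≡ D ℕ.+ s
    len≡D+s = ≡.trans (Vecₚ.length-toList u₀) n≡D+s

  insertTop-desStarMonomials : ∀ {n} (u₀ : Vec (Letter n) n) → insertTopPair desStarMonomial u₀ ≋ Φ* n (desStarMonomial (toSignedWord u₀))
  insertTop-desStarMonomials {n} u₀ = begin
    insertTopPair desStarMonomial u₀
      ≈⟨ +-cong (trans (sumList-insertTop _ (DesStar.signedWeight KQ X Kt) desStarMonomial≋signedWeight u₀ false)
                       (DesStar.insertTop-sum KQ X Kt {n} false 1 ≡.refl l₀ s (≡.cong suc len≡D+s)))
                (+-congʳ (trans (sumList-insertTop _ (DesStar.signedWeight KQ X Kt) desStarMonomial≋signedWeight u₀ true)
                                (DesStar.insertTop-sum KQ X Kt {n} true 1 ≡.refl l₀ s (≡.cong suc len≡D+s)))) ⟩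
    (W ⋆ ((Dq ⊕ P) ⊕ (X ⋆ (KQ ⋆ P)) ⋆ S)) ⋆ T ⊕ ((W ⋆ ((Dq ⊕ P) ⊕ (X ⋆ (KQ ⋆ P)) ⋆ S)) ⋆ (Kt ⋆ T) ⊕ 0ₛ)
      ≈⟨ desStar-identity W T Dq P KQ S Kt X ⟩
    (1+Kt ⋆ ((1-X′ ⋆ Dq ⊕ (Dq ⊕ P ⋆ (oneS ⊕ KQ ⋆ S)) ⋆ X) ⊕ 1-X′ ⋆ P)) ⋆ (W ⋆ T)
      ≈⟨ ⋆-cong (sym (multiplier*≋ {n} {D} {s} n≡D+s)) (sym (desStarMonomial≋signedWeight u₀)) ⟩
    multiplier* n D ⋆ desStarMonomial w₀
      ≡⟨ ≡.cong (λ d → multiplier* n d ⋆ desStarMonomial w₀) (≡.cong (λ l′ → length (desPosFrom 1 l′)) (≡.sym (letters-toSignedWord u₀))) ⟩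
    multiplier* n (desStar w₀) ⋆ desStarMonomial w₀
      ≈⟨ sym (Φ*-monomial n (desStar w₀) (pow q (fmaj k l w₀))) ⟩
    Φ* n (desStarMonomial w₀) ∎
    where
    w₀ = toSignedWord u₀
    l₀ = toList u₀
    D = length (desPosFrom 1 l₀)
    s = n ∸ D
    Dq = 𝕊ᴬ.qint KQ D
    P = 𝕊ᴬ.pow KQ D
    S = 𝕊ᴬ.qint KQ s
    W = DesStar.descentWeight KQ X Kt l₀
    T = 𝕊ᴬ.pow Kt (negL l₀)
    n≡D+s : n ≡ D ℕ.+ s
    n≡D+s = n≡d+[n∸d] {n} (desPosFrom 1) DesStar.length-DL≤ u₀
    len≡D+s : length l₀ ≡ D ℕ.+ s
    len≡D+s = ≡.trans (Vecₚ.length-toList u₀) n≡D+s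

  signedWordSum : (∀ {m} → SignedWord m → Series) → ℕ → Series
  signedWordSum g n = 𝕊ᴬ.sumList g (signedWords n)

  signedWordSum-zero : ∀ (d : ∀ {m} → SignedWord m → ℕ) → d (toSignedWord {0} Vec.[]) ≡ 0 →
                       signedWordSum (λ w → monomial (d w) (pow q (fmaj k l w))) 0 ≋ oneS
  signedWordSum-zero d d[]≡0 m rewrite d[]≡0 with m
  ... | zero = R.trans (R.+-identityʳ _) fmaj-weight-[]
  ... | suc m = R.+-identityʳ _

  signedWordSum-suc : ∀ {F} → Additive F → (g : ∀ {m} → SignedWord m → Series) → ∀ n →
    (∀ (u₀ : Vec (Letter n) n) → insertTopPair g u₀ ≋ F (g (toSignedWord u₀))) →
    signedWordSum g (suc n) ≋ F (signedWordSum g n)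
  signedWordSum-suc {F} F+ g n per-word = begin
    signedWordSum g (suc n)                                       ≈⟨ sumList-signedWords-suc {n} g ⟩
    𝕊ᴬ.sumList (insertTopPair g) (signedPerms n)                  ≈⟨ 𝕊ᶠ.sumList-cong (signedPerms n) per-word ⟩
    𝕊ᴬ.sumList (λ u₀ → F (g (toSignedWord u₀))) (signedPerms n)   ≈⟨ sym (sumList-Additive F+ (g ∘ toSignedWord) (signedPerms n)) ⟩
    F (𝕊ᴬ.sumList (g ∘ toSignedWord) (signedPerms n))             ≈⟨ preserves-≋ F+ (sym (𝕊ᶠ.sumList-map g toSignedWord (signedPerms n))) ⟩
    F (signedWordSum g n)                                         ∎

  desCoefficients⋆poch : ∀ n → desCoefficients n ⋆ poch Q (suc n) ≋ signedWordSum desMonomial n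
  desCoefficients⋆poch zero = trans (constant-coefficients⋆poch₁ (desCoefficients 0) (λ _ → R.refl)) (sym (signedWordSum-zero des ≡.refl))
  desCoefficients⋆poch (suc n) = begin
    desCoefficients (suc n) ⋆ π               ≈⟨ ⋆-congʳ π (desCoefficients-suc n) ⟩
    (A ⋆ ∂ G ⊕ σ G) ⋆ π                       ≈⟨ solve 4 (λ A dG sG π → (A :* dG :+ sG) :* π := A :* (dG :* π) :+ sG :* π) refl A (∂ G) (σ G) π ⟩
    A ⋆ (∂ G ⋆ π) ⊕ σ G ⋆ π                   ≈⟨ +-cong (⋆-congˡ A (∂-⋆-poch n G P (desCoefficients⋆poch n))) (σ-⋆-poch n G P (desCoefficients⋆poch n)) ⟩
    Φ n P                                     ≈⟨ sym (signedWordSum-suc (Φ-Additive n) desMonomial n insertTop-desMonomials) ⟩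
    signedWordSum desMonomial (suc n)         ∎
    where
    A = const (1# + t)
    G = desCoefficients n
    P = signedWordSum desMonomial n
    π = poch Q (suc (suc n))

  desStarCoefficients⋆poch : ∀ n → desStarCoefficients n ⋆ poch Q (suc n) ≋ signedWordSum desStarMonomial n
  desStarCoefficients⋆poch zero = trans (constant-coefficients⋆poch₁ (desStarCoefficients 0) (λ _ → R.*-identityˡ _)) (sym (signedWordSum-zero desStar ≡.refl))
  desStarCoefficients⋆poch (suc n) = begin
    desStarCoefficients (suc n) ⋆ π           ≈⟨ ⋆-congʳ π (desStarCoefficients-suc n) ⟩
    (A ⋆ (∂ G ⊕ σ G)) ⋆ π                     ≈⟨ solve 4 (λ A dG sG π → (A :* (dG :+ sG)) :* π := A :* (dG :* π :+ sG :* π)) refl A (∂ G) (σ G) π ⟩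
    A ⋆ (∂ G ⋆ π ⊕ σ G ⋆ π)                   ≈⟨ ⋆-congˡ A (+-cong (∂-⋆-poch n G P (desStarCoefficients⋆poch n)) (σ-⋆-poch n G P (desStarCoefficients⋆poch n))) ⟩
    Φ* n P                                    ≈⟨ sym (signedWordSum-suc (Φ*-Additive n) desStarMonomial n insertTop-desStarMonomials) ⟩
    signedWordSum desStarMonomial (suc n)     ∎
    where
    A = const (1# + t)
    G = desStarCoefficients n
    P = signedWordSum desStarMonomial n
    π = poch Q (suc (suc n))

corollary4p4 : {c ℓ₁ : Level} (R : CommutativeRing c ℓ₁) (n k ℓ : ℕ) → 1 ≤ n → 1 ≤ k →
    (L : List (SignedWord n)) → Enumerates L →
    (q : CommutativeRing.Carrier R) →
    let open CommutativeRing R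
        open Alg R
        Q = pow q k
    in (fmajSum k ℓ q L ≈ pow (1# + pow q ℓ) n * qfact Q n)
       × ((m : ℕ) → ((λ j → pow (qint Q (suc j) + pow q ℓ * qint Q j) n) ⋆ poch Q (suc n)) m
                       ≈ statSeries des k ℓ q L m)
       × ((m : ℕ) → ((λ j → pow (1# + pow q ℓ) n * pow (qint Q (suc j)) n) ⋆ poch Q (suc n)) m
                       ≈ statSeries desStar k ℓ q L m)
corollary4p4 R n k ℓ _ _ L L-enumerates q =
    trans (Σᴿ.sumList-Enumerates L-enumerates (signedWords-enumerates n) _) (fmajSum-signedWords n)
  , (λ m → trans (desCoefficients⋆poch n m)
                 (trans (Σˢ.sumList-Enumerates (signedWords-enumerates n) L-enumerates desMonomial m) (sym (statSeries≋ des k ℓ q L m))))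
  , (λ m → trans (desStarCoefficients⋆poch n m)
                 (trans (Σˢ.sumList-Enumerates (signedWords-enumerates n) L-enumerates desStarMonomial m) (sym (statSeries≋ desStar k ℓ q L m))))
  where
  open CommutativeRing R using (trans; sym)
  open Enumeration using (signedWords-enumerates)
  open FmajSum R q k ℓ using (fmajSum-signedWords)
  open DescentSeries R q k ℓ using (desCoefficients⋆poch; desStarCoefficients⋆poch; desMonomial; desStarMonomial)
  open Monomials R (Alg.pow R q k) using (statSeries≋)
  module Σᴿ = SignedWordSums R
  module Σˢ = SignedWordSums (PowerSeries.seriesRing R)
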